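{- Let $r$ be an integer, let $c(n;r)=\sum_{j\ge0}\binom{n}{j}^2r^j-\sum_{j\ge0}\binom{n+1}{j}\binom{n-1}{j}r^j$ ($n\ge0$) be the generalized Catalan numbers, and let $h_n(r)$ be the Hankel transform of the sequence $(c(n;r)+c(n+1;r))_{n\ge0}$. Then for all $n\ge0$ $$h_n(r)=r^{\binom{n+1}{2}}\left(\sum_{k=0}^{\lfloor \frac{n+1}{2}\rfloor}\binom{n-k+1}{k}(-r)^k(r+2)^{n-2k+1}-\sum_{k=0}^{\lfloor \frac{n}{2}\rfloor}\binom{n-k}{k}(-r)^k(r+2)^{n-2k}\right).$$ In other words, $h_n(r)=r^{\binom{n+1}{2}}b_r(n+1)$, where $b_r(m)$ is the coefficient of $x^m$ in $\frac{1-x}{1-(r+2)x+rx^2}$. Equivalently, $$h_n(r)=r^{\binom{n+1}{2}}\left(\sum_{k=0}^{n+1}\binom{k}{n-k+1}(r+2)^{2k-n-1}(-r)^{n-k+1}-\sum_{k=0}^n\binom{k}{n-k}(r+2)^{2k-n}(-r)^{n-k}\right) =r^{\binom{n+1}{2}}\sum_{k=0}^{n+1}\binom{n+1}{k}\sum_{j=0}^k\binom{j}{k-j}r^{2j-k} =r^{\binom{n+1}{2}}\sum_{k=0}^{n+1}\binom{n+1}{k}\sum_{j=0}^{\lfloor k/2\rfloor}\binom{k-j}{j}r^{k-2j}.$$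
   Context: The Hankel transform of a sequence $(a_n)_{n\ge 0}$ is the sequence $(h_n)_{n\ge 0}$ with $h_n=\det\big(a_{i+j}\big)_{0\le i,j\le n}$. Binomial coefficients $\binom{a}{b}$ with $b<0$ or $b>a\ge0$ are $0$, and $0^0=1$. -}

module Defs where

open import Data.Nat as ℕ using (ℕ; zero; suc; _∸_; ⌊_/2⌋)
open import Data.Nat.Combinatorics using (_C_)
open import Data.Fin using (Fin; zero; suc; toℕ; punchIn)
open import Data.Integer using (ℤ; +_; _+_; _-_; _*_; -_; _^_)

binom : ℕ → ℕ → ℤ
binom n k = + (n C k)

sumTo : ℕ → (ℕ → ℤ) → ℤ
sumTo zero    f = f 0
sumTo (suc n) f = sumTo n f + f (suc n)

sumFin : (n : ℕ) → (Fin n → ℤ) → ℤ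
sumFin zero    f = + 0
sumFin (suc n) f = f zero + sumFin n (λ i → f (suc i))

det : (n : ℕ) → (Fin n → Fin n → ℤ) → ℤ
det zero    M = + 1
det (suc n) M =
  sumFin (suc n) (λ j → ((- + 1) ^ toℕ j) * (M zero j * det n (λ i k → M (suc i) (punchIn j k))))

hankel : (ℕ → ℤ) → ℕ → ℤ
hankel a n = det (suc n) (λ i j → a (toℕ i ℕ.+ toℕ j))

-- For n ≥ 1 the sums over j ≥ 0 have
-- nonzero terms only for j ≤ n + 1.  For n = 0 the term binom(n-1, j) has
-- negative top; the value c(0;r) = 1 (the generalized Catalan number, i.e.
-- binom(-1,j) read as 0) is used.
catalan : ℤ → ℕ → ℤ
catalan r zero    = + 1
catalan r (suc m) =
  sumTo (suc (suc m)) (λ j → binom (suc m) j * binom (suc m) j * r ^ j)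
  - sumTo (suc (suc m)) (λ j → binom (suc (suc m)) j * binom m j * r ^ j)

catSeq : ℤ → ℕ → ℤ
catSeq r n = catalan r n + catalan r (suc n)

-- b_r(m): coefficient of x^m in (1 - x)/(1 - (r+2)x + r x^2), i.e. the unique
-- coefficient sequence b with (Σ b_m x^m)(1 - (r+2)x + r x^2) = 1 - x,
-- obtained by comparing coefficients of x^0, x^1, x^(m+2).
bcoef : ℤ → ℕ → ℤ
bcoef r zero = + 1
bcoef r (suc zero) = (r + + 2) * bcoef r zero - + 1
bcoef r (suc (suc m)) = (r + + 2) * bcoef r (suc m) - r * bcoef r m

{-# OPTIONS --safe #-}

-- The numbers c(n; r) are the moments of a Jacobi continued fraction: c(n; r) = motzkin n 0, where motzkin n k
-- weights the Motzkin paths of length n ending at height k (level steps r at height 0 and 1 + r above, down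
-- steps r), as one checks by verifying the path recursion for a closed form built from the coefficients of c(n; r).
-- The array motzkin is lower unitriangular and Σₖ motzkin i k · motzkin j k · rᵏ = c(i + j; r), so the Hankel
-- matrix of c(n) + c(n + 1) is motzkin · N with N k j = rᵏ (motzkin j k + motzkin (j + 1) k), and Nᵀ = motzkin · P
-- where Pᵀ is the tridiagonal matrix Q (diagonal 1 + r, 2 + r, 2 + r, …, sub-diagonal 1, super-diagonal r) with row l
-- scaled by rˡ. Hence h_n(r) = r^(n+1 choose 2) · det Q, and expanding det Q along its first row gives the
-- recurrence b(m + 2) = (r + 2) b(m + 1) − r b(m) of the coefficients of (1 − x)/(1 − (r + 2)x + r x²). The other
-- closed forms are Fibonacci-type solutions of this recurrence and the binomial transform of one.
module Submission where

open import Defs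
open import Data.Nat using (ℕ; zero; suc; pred; _∸_; ⌊_/2⌋; _≤_; _<_; z≤n; s≤s)
  renaming (_+_ to _+ℕ_; _*_ to _*ℕ_)
import Data.Nat.Properties as ℕ
open import Data.Nat.Combinatorics using (_C_; nCk+nC[k+1]≡[n+1]C[k+1]; nC1≡n; k>n⇒nCk≡0)
open import Data.Integer using (ℤ; +_; -[1+_]; _+_; _-_; _*_; -_; _^_)
open import Data.Integer.Properties
open import Data.Integer.Tactic.RingSolver using (solve-∀)
open import Algebra.Properties.CommutativeSemigroup *-commutativeSemigroup
  using () renaming (x∙yz≈y∙xz to x*[y*z]≡y*[x*z])
open import Data.Fin using (Fin; zero; suc; toℕ; punchIn; fromℕ<)
import Data.Fin.Properties as Fin
open import Data.Vec.Functional using (Vector; _∷_; tail; updateAt; transpose)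
open import Data.Vec.Functional.Properties
  using (updateAt-updates; updateAt-minimal; updateAt-id-local; map-updateAt-local)
open import Algebra.Properties.Semiring.Sum +-*-semiring using (sum; ∑-distrib-+; *-distribˡ-sum; *-distribʳ-sum)
open import Data.Product using (_×_; _,_)
open import Data.Sum using (inj₁; inj₂)
open import Function using (_∘_; const; flip)
open import Relation.Nullary using (yes; no; contradiction)
open import Relation.Binary.PropositionalEquality
open ≡-Reasoning

-- Finite sums

sumFin≡sum : ∀ n (f : Fin n → ℤ) → sumFin n f ≡ sum f
sumFin≡sum zero    f = refl
sumFin≡sum (suc n) f = cong (_+_ (f zero)) (sumFin≡sum n (f ∘ suc))

sumFin-cong : ∀ n {f g : Fin n → ℤ} → f ≗ g → sumFin n f ≡ sumFin n g
sumFin-cong zero    f≗g = refl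
sumFin-cong (suc n) f≗g = cong₂ _+_ (f≗g zero) (sumFin-cong n (f≗g ∘ suc))

sumFin-distrib-+ : ∀ n (f g : Fin n → ℤ) → sumFin n (λ i → f i + g i) ≡ sumFin n f + sumFin n g
sumFin-distrib-+ n f g
  rewrite sumFin≡sum n (λ i → f i + g i) | sumFin≡sum n f | sumFin≡sum n g = ∑-distrib-+ f g

*-distribˡ-sumFin : ∀ n c (f : Fin n → ℤ) → c * sumFin n f ≡ sumFin n (λ i → c * f i)
*-distribˡ-sumFin n c f rewrite sumFin≡sum n f | sumFin≡sum n (λ i → c * f i) = *-distribˡ-sum c f

*-distribʳ-sumFin : ∀ n c (f : Fin n → ℤ) → sumFin n f * c ≡ sumFin n (λ i → f i * c)
*-distribʳ-sumFin n c f rewrite sumFin≡sum n f | sumFin≡sum n (λ i → f i * c) = *-distribʳ-sum c f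

sumFin-zero : ∀ n {f : Fin n → ℤ} → (∀ i → f i ≡ + 0) → sumFin n f ≡ + 0
sumFin-zero zero    f≡0 = refl
sumFin-zero (suc n) f≡0 = cong₂ _+_ (f≡0 zero) (sumFin-zero n (f≡0 ∘ suc))

sumFin-comm : ∀ m n (f : Fin m → Fin n → ℤ) →
  sumFin m (λ i → sumFin n (f i)) ≡ sumFin n (λ j → sumFin m (λ i → f i j))
sumFin-comm zero    n f = sym (sumFin-zero n (λ _ → refl))
sumFin-comm (suc m) n f = trans (cong (_+_ (sumFin n (f zero))) (sumFin-comm m n (f ∘ suc)))
                                (sym (sumFin-distrib-+ n (f zero) _))

sumFin-sift : ∀ n (f : Fin n → ℤ) k → (∀ i → i ≢ k → f i ≡ + 0) → sumFin n f ≡ f k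
sumFin-sift (suc n) f zero    f≡0 =
  trans (cong (_+_ (f zero)) (sumFin-zero n (λ i → f≡0 (suc i) (λ ())))) (+-identityʳ (f zero))
sumFin-sift (suc n) f (suc k) f≡0 =
  trans (cong (_+ sumFin n (f ∘ suc)) (f≡0 zero (λ ())))
        (trans (+-identityˡ _) (sumFin-sift n (f ∘ suc) k (λ i i≢k → f≡0 (suc i) (i≢k ∘ Fin.suc-injective))))

sumFin-interchange : ∀ n m (c : Fin n → ℤ) (w : Fin m → ℤ) (x : Fin n → Fin m → ℤ) →
  sumFin n (λ j → c j * sumFin m (λ k → w k * x j k)) ≡ sumFin m (λ k → w k * sumFin n (λ j → c j * x j k))
sumFin-interchange n m c w x = begin
  sumFin n (λ j → c j * sumFin m (λ k → w k * x j k))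
    ≡⟨ sumFin-cong n (λ j → trans (*-distribˡ-sumFin m (c j) _) (sumFin-cong m (λ k → x*[y*z]≡y*[x*z] (c j) (w k) (x j k)))) ⟩
  sumFin n (λ j → sumFin m (λ k → w k * (c j * x j k)))
    ≡⟨ sumFin-comm n m _ ⟩
  sumFin m (λ k → sumFin n (λ j → w k * (c j * x j k)))
    ≡⟨ sumFin-cong m (λ k → *-distribˡ-sumFin n (w k) _) ⟨
  sumFin m (λ k → w k * sumFin n (λ j → c j * x j k)) ∎

sumTo-cong : ∀ n {f g : ℕ → ℤ} → f ≗ g → sumTo n f ≡ sumTo n g
sumTo-cong zero    f≗g = f≗g 0
sumTo-cong (suc n) f≗g = cong₂ _+_ (sumTo-cong n f≗g) (f≗g (suc n))

sumTo-cong-≤ : ∀ n {f g : ℕ → ℤ} → (∀ k → k ≤ n → f k ≡ g k) → sumTo n f ≡ sumTo n g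
sumTo-cong-≤ zero    f≡g = f≡g 0 z≤n
sumTo-cong-≤ (suc n) f≡g =
  cong₂ _+_ (sumTo-cong-≤ n (λ k k≤n → f≡g k (ℕ.m≤n⇒m≤1+n k≤n))) (f≡g (suc n) ℕ.≤-refl)

sumTo-distrib-+ : ∀ n (f g : ℕ → ℤ) → sumTo n (λ k → f k + g k) ≡ sumTo n f + sumTo n g
sumTo-distrib-+ zero    f g = refl
sumTo-distrib-+ (suc n) f g =
  trans (cong (_+ (f (suc n) + g (suc n))) (sumTo-distrib-+ n f g)) (+-interchange (sumTo n f) (sumTo n g) (f (suc n)) (g (suc n)))
  where
  +-interchange : ∀ a b c d → a + b + (c + d) ≡ a + c + (b + d)
  +-interchange = solve-∀

sumTo-distrib-- : ∀ n (f g : ℕ → ℤ) → sumTo n (λ k → f k - g k) ≡ sumTo n f - sumTo n g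
sumTo-distrib-- n f g = trans (sumTo-distrib-+ n f (λ k → - g k)) (cong (_+_ (sumTo n f)) (sumTo-neg n))
  where
  sumTo-neg : ∀ n → sumTo n (λ k → - g k) ≡ - sumTo n g
  sumTo-neg zero    = refl
  sumTo-neg (suc n) = trans (cong (_- g (suc n)) (sumTo-neg n)) (sym (neg-distrib-+ (sumTo n g) (g (suc n))))

*-distribˡ-sumTo : ∀ n c (f : ℕ → ℤ) → c * sumTo n f ≡ sumTo n (λ k → c * f k)
*-distribˡ-sumTo zero    c f = refl
*-distribˡ-sumTo (suc n) c f =
  trans (*-distribˡ-+ c (sumTo n f) (f (suc n))) (cong (_+ c * f (suc n)) (*-distribˡ-sumTo n c f))

sumTo-shift : ∀ n (f : ℕ → ℤ) → sumTo (suc n) f ≡ f 0 + sumTo n (f ∘ suc)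
sumTo-shift zero    f = refl
sumTo-shift (suc n) f = trans (cong (_+ f (suc (suc n))) (sumTo-shift n f)) (+-assoc (f 0) _ _)

sumTo-first : ∀ n (f : ℕ → ℤ) → (∀ k → f (suc k) ≡ + 0) → sumTo n f ≡ f 0
sumTo-first zero    f f≡0 = refl
sumTo-first (suc n) f f≡0 = trans (cong₂ _+_ (sumTo-first n f f≡0) (f≡0 n)) (+-identityʳ (f 0))

sumTo-extend : ∀ m n (f : ℕ → ℤ) → m ≤ n → (∀ k → m < k → f k ≡ + 0) → sumTo m f ≡ sumTo n f
sumTo-extend m zero    f z≤n f≡0 = refl
sumTo-extend m (suc n) f m≤1+n f≡0 with ℕ.m≤n⇒m<n∨m≡n m≤1+n
... | inj₂ refl = refl
... | inj₁ m<1+n = trans (sumTo-extend m n f (ℕ.≤-pred m<1+n) f≡0)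
                         (sym (trans (cong (_+_ (sumTo n f)) (f≡0 (suc n) m<1+n)) (+-identityʳ (sumTo n f))))

sumTo-reverse : ∀ n (f : ℕ → ℤ) → sumTo n f ≡ sumTo n (λ k → f (n ∸ k))
sumTo-reverse zero    f = refl
sumTo-reverse (suc n) f = sym (begin
  sumTo (suc n) (λ k → f (suc n ∸ k))     ≡⟨ sumTo-shift n (λ k → f (suc n ∸ k)) ⟩
  f (suc n) + sumTo n (λ k → f (n ∸ k))   ≡⟨ cong (_+_ (f (suc n))) (sumTo-reverse n f) ⟨
  f (suc n) + sumTo n f                   ≡⟨ +-comm (f (suc n)) (sumTo n f) ⟩
  sumTo (suc n) f                         ∎)

sumFin-toℕ : ∀ n (f : ℕ → ℤ) → sumFin (suc n) (f ∘ toℕ) ≡ sumTo n f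
sumFin-toℕ zero    f = +-identityʳ (f 0)
sumFin-toℕ (suc n) f = trans (cong (_+_ (f 0)) (sumFin-toℕ n (f ∘ suc))) (sym (sumTo-shift n f))

prev : (ℕ → ℤ) → ℕ → ℤ
prev u zero    = + 0
prev u (suc k) = u k

binom-suc : ∀ n k → binom (suc n) k ≡ binom n k + prev (binom n) k
binom-suc n zero    = refl
binom-suc n (suc k) = trans (cong +_ (sym (nCk+nC[k+1]≡[n+1]C[k+1] n k)))
                            (trans (pos-+ (n C k) (n C suc k)) (+-comm (binom n k) (binom n (suc k))))

binom-vanish : ∀ {n k} → n < k → binom n k ≡ + 0
binom-vanish n<k = cong +_ (k>n⇒nCk≡0 n<k)

-- Determinants

Matrix : ℕ → Set
Matrix n = Fin n → Fin n → ℤ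

minor : ∀ {n} → Matrix (suc n) → Fin (suc n) → Matrix n
minor A j i k = A (suc i) (punchIn j k)

sign : ∀ {n} → Fin n → ℤ
sign j = (- + 1) ^ toℕ j

altSum : ∀ n → (Fin n → ℤ) → ℤ
altSum n f = sumFin n (λ j → sign j * f j)

altSum-cong : ∀ n {f g : Fin n → ℤ} → f ≗ g → altSum n f ≡ altSum n g
altSum-cong n f≗g = sumFin-cong n (λ j → cong (sign j *_) (f≗g j))

*-distribˡ-altSum : ∀ n c (f : Fin n → ℤ) → c * altSum n f ≡ altSum n (λ j → c * f j)
*-distribˡ-altSum n c f = trans (*-distribˡ-sumFin n c _) (sumFin-cong n (λ j → x*[y*z]≡y*[x*z] c (sign j) (f j)))

altSum-zero : ∀ n {f : Fin n → ℤ} → (∀ j → f j ≡ + 0) → altSum n f ≡ + 0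
altSum-zero n f≡0 = sumFin-zero n (λ j → trans (cong (sign j *_) (f≡0 j)) (*-zeroʳ (sign j)))

altSum-suc : ∀ n (f : Fin (suc n) → ℤ) → altSum (suc n) f ≡ f zero - altSum n (f ∘ suc)
altSum-suc n f = cong₂ _+_ (*-identityˡ (f zero)) (begin
  sumFin n (λ j → - + 1 * sign j * f (suc j))  ≡⟨ sumFin-cong n (λ j → *-assoc (- + 1) (sign j) (f (suc j))) ⟩
  sumFin n (λ j → - + 1 * (sign j * f (suc j))) ≡⟨ *-distribˡ-sumFin n (- + 1) _ ⟨
  - + 1 * altSum n (f ∘ suc)                   ≡⟨ -1*i≡-i (altSum n (f ∘ suc)) ⟩
  - altSum n (f ∘ suc)                         ∎)

altSum-distrib-- : ∀ n (f g : Fin n → ℤ) → altSum n (λ j → f j - g j) ≡ altSum n f - altSum n g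
altSum-distrib-- zero    f g = refl
altSum-distrib-- (suc n) f g = begin
  altSum (suc n) (λ j → f j - g j)                               ≡⟨ altSum-suc n (λ j → f j - g j) ⟩
  f zero - g zero - altSum n (λ j → f (suc j) - g (suc j))       ≡⟨ cong (_-_ (f zero - g zero)) (altSum-distrib-- n (f ∘ suc) (g ∘ suc)) ⟩
  f zero - g zero - (altSum n (f ∘ suc) - altSum n (g ∘ suc))    ≡⟨ regroup (f zero) (g zero) _ _ ⟩
  (f zero - altSum n (f ∘ suc)) - (g zero - altSum n (g ∘ suc))  ≡⟨ cong₂ _-_ (altSum-suc n f) (altSum-suc n g) ⟨
  altSum (suc n) f - altSum (suc n) g                            ∎
  where
  regroup : ∀ a b c d → a - b - (c - d) ≡ (a - c) - (b - d)
  regroup = solve-∀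

det-cong : ∀ n {A B : Matrix n} → (∀ i j → A i j ≡ B i j) → det n A ≡ det n B
det-cong zero    A≡B = refl
det-cong (suc n) A≡B =
  altSum-cong (suc n) (λ j → cong₂ _*_ (A≡B zero j) (det-cong n (λ i k → A≡B (suc i) (punchIn j k))))

partner : ∀ {n} → Fin (suc n) → Fin n → Fin n
partner zero    zero    = zero
partner zero    (suc l) = zero
partner (suc j) zero    = j
partner (suc j) (suc l) = suc (partner j l)

partner-zero : ∀ {n} (l : Fin (suc n)) → partner zero l ≡ zero
partner-zero zero    = refl
partner-zero (suc l) = refl

punchIn-partner : ∀ {n} (j : Fin (suc n)) (l : Fin n) → punchIn (punchIn j l) (partner j l) ≡ j
punchIn-partner zero    zero    = refl
punchIn-partner zero    (suc l) = refl
punchIn-partner (suc j) zero    = refl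
punchIn-partner (suc j) (suc l) = cong suc (punchIn-partner j l)

punchIn-punchIn-partner : ∀ {n} (j : Fin (suc (suc n))) (l : Fin (suc n)) (k : Fin n) →
  punchIn j (punchIn l k) ≡ punchIn (punchIn j l) (punchIn (partner j l) k)
punchIn-punchIn-partner zero    zero    k       = refl
punchIn-punchIn-partner zero    (suc l) k       = refl
punchIn-punchIn-partner (suc j) zero    k       = refl
punchIn-punchIn-partner (suc j) (suc l) zero    = refl
punchIn-punchIn-partner (suc j) (suc l) (suc k) = cong suc (punchIn-punchIn-partner j l k)

-- Expanding a determinant along two rows gives a signed sum over ordered pairs of distinct
-- columns (j , punchIn j l); the pair (punchIn j l , partner j l) lists the same columns swapped.
pairSum : ∀ n → (Fin (suc n) → Fin n → ℤ) → ℤ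
pairSum n G = altSum (suc n) (λ j → altSum n (G j))

pairSum-suc : ∀ n (G : Fin (suc (suc n)) → Fin (suc n) → ℤ) →
  pairSum (suc n) G ≡ altSum (suc n) (G zero) - altSum (suc n) (λ j → G (suc j) zero)
                      + pairSum n (λ j l → G (suc j) (suc l))
pairSum-suc n G = begin
  pairSum (suc n) G
    ≡⟨ altSum-suc (suc n) (λ j → altSum (suc n) (G j)) ⟩
  A - altSum (suc n) (λ j → altSum (suc n) (G (suc j)))
    ≡⟨ cong (_-_ A) (altSum-cong (suc n) (λ j → altSum-suc n (G (suc j)))) ⟩
  A - altSum (suc n) (λ j → G (suc j) zero - altSum n (G (suc j) ∘ suc))
    ≡⟨ cong (_-_ A) (altSum-distrib-- (suc n) (λ j → G (suc j) zero) (λ j → altSum n (G (suc j) ∘ suc))) ⟩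
  A - (B - pairSum n (λ j l → G (suc j) (suc l)))
    ≡⟨ a-[b-c]≡a-b+c A B _ ⟩
  A - B + pairSum n (λ j l → G (suc j) (suc l)) ∎
  where
  A = altSum (suc n) (G zero)
  B = altSum (suc n) (λ j → G (suc j) zero)
  a-[b-c]≡a-b+c : ∀ a b c → a - (b - c) ≡ a - b + c
  a-[b-c]≡a-b+c = solve-∀

pairSum-swap : ∀ n (G H : Fin (suc n) → Fin n → ℤ) →
  (∀ j l → G j l ≡ H (punchIn j l) (partner j l)) → pairSum n G ≡ - pairSum n H
pairSum-swap zero    G H G≡H = refl
pairSum-swap (suc n) G H G≡H = begin
  pairSum (suc n) G                                     ≡⟨ pairSum-suc n G ⟩
  altSum (suc n) (G zero) - altSum (suc n) (λ j → G (suc j) zero) + pairSum n G′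
    ≡⟨ cong₂ _+_ (cong₂ _-_ row≡col col≡row) (pairSum-swap n G′ H′ (λ j l → G≡H (suc j) (suc l))) ⟩
  altSum (suc n) (λ j → H (suc j) zero) - altSum (suc n) (H zero) + - pairSum n H′
    ≡⟨ b-a+-c≡-[a-b+c] (altSum (suc n) (H zero)) _ _ ⟩
  - (altSum (suc n) (H zero) - altSum (suc n) (λ j → H (suc j) zero) + pairSum n H′)
    ≡⟨ cong -_ (pairSum-suc n H) ⟨
  - pairSum (suc n) H                                   ∎
  where
  G′ H′ : Fin (suc n) → Fin n → ℤ
  G′ j l = G (suc j) (suc l)
  H′ j l = H (suc j) (suc l)
  row≡col : altSum (suc n) (G zero) ≡ altSum (suc n) (λ j → H (suc j) zero)
  row≡col = altSum-cong (suc n) (λ l → trans (G≡H zero l) (cong (H (suc l)) (partner-zero l)))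
  col≡row : altSum (suc n) (λ j → G (suc j) zero) ≡ altSum (suc n) (H zero)
  col≡row = altSum-cong (suc n) (λ j → G≡H (suc j) zero)
  b-a+-c≡-[a-b+c] : ∀ a b c → b - a + - c ≡ - (a - b + c)
  b-a+-c≡-[a-b+c] = solve-∀

x≡-x⇒x≡0 : ∀ {x} → x ≡ - x → x ≡ + 0
x≡-x⇒x≡0 {+ zero}    _  = refl
x≡-x⇒x≡0 {+ (suc n)} ()
x≡-x⇒x≡0 { -[1+ n ]} ()

det-∷-repeated : ∀ n (B : Fin n → Fin (suc n) → ℤ) (k : Fin n) → det (suc n) (B k ∷ B) ≡ + 0
det-∷-repeated (suc m) B k =
  trans (altSum-cong (suc (suc m)) (λ j → *-distribˡ-altSum (suc m) (B k j) (λ l → B zero (punchIn j l) * D j l))) (vanish k)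
  where
  D : Fin (suc (suc m)) → Fin (suc m) → ℤ
  D j l = det m (λ i c → B (suc i) (punchIn j (punchIn l c)))
  D-swap : ∀ j l → D j l ≡ D (punchIn j l) (partner j l)
  D-swap j l = det-cong m (λ i c → cong (B (suc i)) (punchIn-punchIn-partner j l c))
  G : Fin (suc m) → Fin (suc (suc m)) → Fin (suc m) → ℤ
  G k j l = B k j * (B zero (punchIn j l) * D j l)
  vanish : ∀ k → pairSum (suc m) (G k) ≡ + 0
  vanish zero = x≡-x⇒x≡0 (pairSum-swap (suc m) (G zero) (G zero) (λ j l → begin
    B zero j * (B zero (punchIn j l) * D j l)
      ≡⟨ x*[y*z]≡y*[x*z] (B zero j) (B zero (punchIn j l)) (D j l) ⟩
    B zero (punchIn j l) * (B zero j * D j l)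
      ≡⟨ cong₂ (λ x y → B zero (punchIn j l) * (B zero x * y)) (punchIn-partner j l) (sym (D-swap j l)) ⟨
    G zero (punchIn j l) (partner j l) ∎))
  vanish (suc k) = trans (pairSum-swap (suc m) (G (suc k)) H G≡H) (cong -_ H-vanishes)
    where
    H : Fin (suc (suc m)) → Fin (suc m) → ℤ
    H j l = B (suc k) (punchIn j l) * (B zero j * D j l)
    G≡H : ∀ j l → G (suc k) j l ≡ H (punchIn j l) (partner j l)
    G≡H j l = cong₂ (λ x y → B (suc k) x * (B zero (punchIn j l) * y)) (sym (punchIn-partner j l)) (D-swap j l)
    H-vanishes : pairSum (suc m) H ≡ + 0
    H-vanishes = altSum-zero (suc (suc m)) (λ j → begin
      altSum (suc m) (H j)
        ≡⟨ altSum-cong (suc m) (λ l → x*[y*z]≡y*[x*z] (B (suc k) (punchIn j l)) (B zero j) (D j l)) ⟩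
      altSum (suc m) (λ l → B zero j * (B (suc k) (punchIn j l) * D j l))
        ≡⟨ *-distribˡ-altSum (suc m) (B zero j) (λ l → B (suc k) (punchIn j l) * D j l) ⟨
      B zero j * det (suc m) (λ i c → (B (suc k) ∷ tail B) i (punchIn j c))
        ≡⟨ cong (B zero j *_) (det-∷-repeated m (λ i c → B (suc i) (punchIn j c)) k) ⟩
      B zero j * + 0
        ≡⟨ *-zeroʳ (B zero j) ⟩
      + 0 ∎)

det-equalRows : ∀ n (A : Matrix n) {p q : Fin n} → p ≢ q → A p ≗ A q → det n A ≡ + 0
det-equalRows (suc n) A {zero}  {zero}  p≢q _ = contradiction refl p≢q
det-equalRows (suc n) A {zero}  {suc q} _ Ap≗Aq =
  trans (det-cong (suc n) rows) (det-∷-repeated n (tail A) q)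
  where
  rows : ∀ i j → A i j ≡ (A (suc q) ∷ tail A) i j
  rows zero    j = Ap≗Aq j
  rows (suc i) j = refl
det-equalRows (suc n) A {suc p} {zero}  _ Ap≗Aq =
  det-equalRows (suc n) A {zero} {suc p} (λ ()) (sym ∘ Ap≗Aq)
det-equalRows (suc n) A {suc p} {suc q} p≢q Ap≗Aq = altSum-zero (suc n) (λ j → begin
  A zero j * det n (minor A j)  ≡⟨ cong (A zero j *_) (det-equalRows n (minor A j) (p≢q ∘ cong suc) (Ap≗Aq ∘ punchIn j)) ⟩
  A zero j * + 0                ≡⟨ *-zeroʳ (A zero j) ⟩
  + 0                           ∎)

replaceRow : ∀ {m n} → Vector (Fin n → ℤ) m → Fin m → (Fin n → ℤ) → Vector (Fin n → ℤ) m
replaceRow A f v = updateAt A f (const v)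

replaceRow-cong : ∀ {m n} (A : Vector (Fin n → ℤ) m) f {u v : Fin n → ℤ} → u ≗ v →
  ∀ i j → replaceRow A f u i j ≡ replaceRow A f v i j
replaceRow-cong A zero    u≗v zero    j = u≗v j
replaceRow-cong A zero    u≗v (suc i) j = refl
replaceRow-cong A (suc f) u≗v zero    j = refl
replaceRow-cong A (suc f) u≗v (suc i) j = replaceRow-cong (tail A) f u≗v i j

minor-replaceRow : ∀ {n} (A : Matrix (suc n)) f v j i k →
  minor (replaceRow A (suc f) v) j i k ≡ replaceRow (minor A j) f (v ∘ punchIn j) i k
minor-replaceRow A f v j i k = cong-app (map-updateAt-local {f = _∘ punchIn j} (tail A) f refl i) k

det-replaceRow-linear : ∀ n m (A : Matrix n) f (w : Fin m → ℤ) (V : Fin m → Fin n → ℤ) →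
  det n (replaceRow A f (λ j → sumFin m (λ k → w k * V k j)))
    ≡ sumFin m (λ k → w k * det n (replaceRow A f (V k)))
det-replaceRow-linear (suc n) m A zero w V = begin
  altSum (suc n) (λ j → sumFin m (λ k → w k * V k j) * D j)
    ≡⟨ altSum-cong (suc n) (λ j → *-distribʳ-sumFin m (D j) (λ k → w k * V k j)) ⟩
  altSum (suc n) (λ j → sumFin m (λ k → w k * V k j * D j))
    ≡⟨ altSum-cong (suc n) (λ j → sumFin-cong m (λ k → *-assoc (w k) (V k j) (D j))) ⟩
  altSum (suc n) (λ j → sumFin m (λ k → w k * (V k j * D j)))
    ≡⟨ sumFin-interchange (suc n) m sign w (λ j k → V k j * D j) ⟩
  sumFin m (λ k → w k * det (suc n) (replaceRow A zero (V k))) ∎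
  where
  D : Fin (suc n) → ℤ
  D j = det n (minor A j)
det-replaceRow-linear (suc n) m A (suc f) w V = begin
  altSum (suc n) (λ j → A zero j * det n (minor (replaceRow A (suc f) (λ j → sumFin m (λ k → w k * V k j))) j))
    ≡⟨ altSum-cong (suc n) (λ j → cong (A zero j *_) (trans
         (det-cong n (minor-replaceRow A f (λ j → sumFin m (λ k → w k * V k j)) j))
         (det-replaceRow-linear n m (minor A j) f w (λ k → V k ∘ punchIn j)))) ⟩
  altSum (suc n) (λ j → A zero j * sumFin m (λ k → w k * M j k))
    ≡⟨ altSum-cong (suc n) (λ j → *-distribˡ-sumFin m (A zero j) (λ k → w k * M j k)) ⟩
  altSum (suc n) (λ j → sumFin m (λ k → A zero j * (w k * M j k)))
    ≡⟨ altSum-cong (suc n) (λ j → sumFin-cong m (λ k → x*[y*z]≡y*[x*z] (A zero j) (w k) (M j k))) ⟩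
  altSum (suc n) (λ j → sumFin m (λ k → w k * (A zero j * M j k)))
    ≡⟨ sumFin-interchange (suc n) m sign w (λ j k → A zero j * M j k) ⟩
  sumFin m (λ k → w k * altSum (suc n) (λ j → A zero j * M j k))
    ≡⟨ sumFin-cong m (λ k → cong (w k *_) (altSum-cong (suc n) (λ j →
         cong (A zero j *_) (det-cong n (λ i l → sym (minor-replaceRow A f (V k) j i l)))))) ⟩
  sumFin m (λ k → w k * det (suc n) (replaceRow A (suc f) (V k))) ∎
  where
  M : Fin (suc n) → Fin m → ℤ
  M j k = det n (replaceRow (minor A j) f (V k ∘ punchIn j))

det-replaceRow-combination : ∀ n (A : Matrix n) f (w : Fin n → ℤ) → w f ≡ + 1 →
  det n (replaceRow A f (λ j → sumFin n (λ k → w k * A k j))) ≡ det n A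
det-replaceRow-combination n A f w wf≡1 = begin
  det n (replaceRow A f (λ j → sumFin n (λ k → w k * A k j)))
    ≡⟨ det-replaceRow-linear n n A f w A ⟩
  sumFin n (λ k → w k * det n (replaceRow A f (A k)))
    ≡⟨ sumFin-sift n _ f (λ k k≢f → trans (cong (w k *_) (det-equalRows n _ k≢f (repeated k k≢f))) (*-zeroʳ (w k))) ⟩
  w f * det n (replaceRow A f (A f))
    ≡⟨ cong₂ _*_ wf≡1 (det-cong n (λ i → cong-app (updateAt-id-local f A refl i))) ⟩
  + 1 * det n A
    ≡⟨ *-identityˡ (det n A) ⟩
  det n A ∎
  where
  repeated : ∀ k → k ≢ f → replaceRow A f (A k) k ≗ replaceRow A f (A k) f
  repeated k k≢f j = trans (cong-app (updateAt-minimal k f A k≢f) j) (sym (cong-app (updateAt-updates f A) j))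

det-lowerUnitriangular : ∀ n (T A B : Matrix n) → (∀ i → T i i ≡ + 1) → (∀ i k → toℕ i < toℕ k → T i k ≡ + 0) →
  (∀ i j → B i j ≡ sumFin n (λ k → T i k * A k j)) → det n B ≡ det n A
det-lowerUnitriangular n T A B Tii≡1 T-lower B≡TA =
  sym (sweep n ℕ.≤-refl A (λ _ _ _ → refl) (λ i n≤i → contradiction (Fin.toℕ<n i) (ℕ.≤⇒≯ n≤i)))
  where
  -- Replace the rows of B by those of A from the top down; each step is a row operation.
  sweep : ∀ t → t ≤ n → (Y : Matrix n) → (∀ i → toℕ i < t → Y i ≗ A i) → (∀ i → t ≤ toℕ i → Y i ≗ B i) →
    det n Y ≡ det n B
  sweep zero    _   Y _   Y≗B = det-cong n (λ i → Y≗B i z≤n)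
  sweep (suc t) t<n Y Y≗A Y≗B = trans (sym Y′≡Y) (sweep t (ℕ.<⇒≤ t<n) Y′ Y′≗A Y′≗B)
    where
    f : Fin n
    f = fromℕ< t<n
    toℕ-≢f : ∀ {i} → i ≢ f → toℕ i ≢ t
    toℕ-≢f i≢f toℕi≡t = i≢f (Fin.toℕ-injective (trans toℕi≡t (sym (Fin.toℕ-fromℕ< t<n))))
    Y′ : Matrix n
    Y′ = replaceRow Y f (B f)
    Y′≗A : ∀ i → toℕ i < t → Y′ i ≗ A i
    Y′≗A i i<t j = trans (cong-app (updateAt-minimal i f Y i≢f) j) (Y≗A i (ℕ.m<n⇒m<1+n i<t) j)
      where
      i≢f : i ≢ f
      i≢f i≡f = ℕ.<-irrefl (trans (cong toℕ i≡f) (Fin.toℕ-fromℕ< t<n)) i<t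
    Y′≗B : ∀ i → t ≤ toℕ i → Y′ i ≗ B i
    Y′≗B i t≤i j with i Fin.≟ f
    ... | yes refl = cong-app (updateAt-updates f Y) j
    ... | no i≢f   = trans (cong-app (updateAt-minimal i f Y i≢f) j)
                           (Y≗B i (ℕ.≤∧≢⇒< t≤i (toℕ-≢f i≢f ∘ sym)) j)
    TY≡TA : ∀ j k → T f k * Y k j ≡ T f k * A k j
    TY≡TA j k with toℕ k ℕ.≤? t
    ... | yes k≤t = cong (T f k *_) (Y≗A k (s≤s k≤t) j)
    ... | no  k≰t = trans (cong (_* Y k j) Tfk≡0) (trans (*-zeroˡ (Y k j)) (sym (trans (cong (_* A k j) Tfk≡0) (*-zeroˡ (A k j)))))
      where
      Tfk≡0 : T f k ≡ + 0
      Tfk≡0 = T-lower f k (subst (_< toℕ k) (sym (Fin.toℕ-fromℕ< t<n)) (ℕ.≰⇒> k≰t))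
    Y′≡Y : det n Y′ ≡ det n Y
    Y′≡Y = trans (det-cong n (replaceRow-cong Y f (λ j → trans (B≡TA f j) (sumFin-cong n (λ k → sym (TY≡TA j k))))))
                 (det-replaceRow-combination n Y f (T f) (Tii≡1 f))

columnExpansion : ∀ n → Matrix (suc n) → ℤ
columnExpansion n A = altSum (suc n) (λ i → A i zero * det n (λ a b → A (punchIn i a) (suc b)))

TransposeInvariant : ℕ → Set
TransposeInvariant n = ∀ (A : Matrix n) → det n (transpose A) ≡ det n A

det-transpose≡columnExpansion : ∀ n → TransposeInvariant n → ∀ (A : Matrix (suc n)) →
  det (suc n) (transpose A) ≡ columnExpansion n A
det-transpose≡columnExpansion n invariant A =
  altSum-cong (suc n) (λ j → cong (A j zero *_) (invariant (λ a b → A (punchIn j a) (suc b))))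

-- Both sides, expanded once more, are the same double sum over the entries A 0 (1+j) and A (1+i) 0.
det≡columnExpansion : ∀ n → TransposeInvariant n → TransposeInvariant (suc n) → ∀ (A : Matrix (suc (suc n))) →
  det (suc (suc n)) A ≡ columnExpansion (suc n) A
det≡columnExpansion n invariant invariant′ A =
  cong (_+_ (sign {suc (suc n)} zero * (A zero zero * det (suc n) (minor A zero)))) (begin
  sumFin (suc n) (λ j → sign (suc j) * (a j * det (suc n) (minor A (suc j))))
    ≡⟨ sumFin-cong (suc n) (λ j → trans (cong (λ x → sign (suc j) * (a j * x)) (expand j))
                                        (pushIn (sign (suc j)) (a j) (λ i → sign i * (b i * K i j)))) ⟩
  sumFin (suc n) (λ j → sumFin (suc n) (λ i → sign (suc j) * (a j * (sign i * (b i * K i j)))))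
    ≡⟨ sumFin-comm (suc n) (suc n) (λ j i → sign (suc j) * (a j * (sign i * (b i * K i j)))) ⟩
  sumFin (suc n) (λ i → sumFin (suc n) (λ j → sign (suc j) * (a j * (sign i * (b i * K i j)))))
    ≡⟨ sumFin-cong (suc n) (λ i → trans (sumFin-cong (suc n) (λ j → exchange (sign j) (sign i) (a j) (b i) (K i j)))
                                        (sym (pushIn (sign (suc i)) (b i) (λ j → sign j * (a j * K i j))))) ⟩
  sumFin (suc n) (λ i → sign (suc i) * (b i * det (suc n) (λ a b → A (punchIn (suc i) a) (suc b)))) ∎)
  where
  a b : Fin (suc n) → ℤ
  a j = A zero (suc j)
  b i = A (suc i) zero
  K : Fin (suc n) → Fin (suc n) → ℤ
  K i j = det n (λ x y → A (suc (punchIn i x)) (suc (punchIn j y)))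
  expand : ∀ j → det (suc n) (minor A (suc j)) ≡ altSum (suc n) (λ i → b i * K i j)
  expand j = trans (sym (invariant′ (minor A (suc j)))) (det-transpose≡columnExpansion n invariant (minor A (suc j)))
  pushIn : ∀ c d (f : Fin (suc n) → ℤ) → c * (d * sumFin (suc n) f) ≡ sumFin (suc n) (λ i → c * (d * f i))
  pushIn c d f = trans (cong (c *_) (*-distribˡ-sumFin (suc n) d f)) (*-distribˡ-sumFin (suc n) c (λ i → d * f i))
  exchange : ∀ sj si x y k → (- + 1 * sj) * (x * (si * (y * k))) ≡ (- + 1 * si) * (y * (sj * (x * k)))
  exchange = solve-∀

det-transpose : ∀ n → TransposeInvariant n
det-transpose zero          A = refl
det-transpose (suc zero)    A = refl
det-transpose (suc (suc n)) A = trans (det-transpose≡columnExpansion (suc n) (det-transpose (suc n)) A)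
                                      (sym (det≡columnExpansion n (det-transpose n) (det-transpose (suc n)) A))

det-scale : ∀ n c (A : Matrix n) → det n (λ i j → c * A i j) ≡ c ^ n * det n A
det-scale zero    c A = refl
det-scale (suc n) c A = trans
  (altSum-cong (suc n) (λ j → trans (cong (c * A zero j *_) (det-scale n c (minor A j)))
                                    (regroup c (A zero j) (c ^ n) (det n (minor A j)))))
  (sym (*-distribˡ-altSum (suc n) (c ^ suc n) (λ j → A zero j * det n (minor A j))))
  where
  regroup : ∀ c a cn d → c * a * (cn * d) ≡ c * cn * (a * d)
  regroup = solve-∀

[1+n]C2≡n+nC2 : ∀ n → suc n C 2 ≡ n +ℕ n C 2
[1+n]C2≡n+nC2 n = trans (sym (nCk+nC[k+1]≡[n+1]C[k+1] n 1)) (cong (_+ℕ n C 2) (nC1≡n n))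

det-scaleRows-^ : ∀ n c (A : Matrix n) → det n (λ i j → c ^ toℕ i * A i j) ≡ c ^ (n C 2) * det n A
det-scaleRows-^ zero    c A = refl
det-scaleRows-^ (suc n) c A = begin
  altSum (suc n) (λ j → + 1 * A zero j * det n (λ i k → c * c ^ toℕ i * minor A j i k))
    ≡⟨ altSum-cong (suc n) (λ j → cong (+ 1 * A zero j *_) (begin
         det n (λ i k → c * c ^ toℕ i * minor A j i k)     ≡⟨ det-cong n (λ i k → *-assoc c _ _) ⟩
         det n (λ i k → c * (c ^ toℕ i * minor A j i k))   ≡⟨ det-scale n c _ ⟩
         c ^ n * det n (λ i k → c ^ toℕ i * minor A j i k) ≡⟨ cong (c ^ n *_) (det-scaleRows-^ n c (minor A j)) ⟩
         c ^ n * (c ^ (n C 2) * det n (minor A j))         ∎)) ⟩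
  altSum (suc n) (λ j → + 1 * A zero j * (c ^ n * (c ^ (n C 2) * det n (minor A j))))
    ≡⟨ altSum-cong (suc n) (λ j → regroup (A zero j) (c ^ n) (c ^ (n C 2)) (det n (minor A j))) ⟩
  altSum (suc n) (λ j → c ^ n * c ^ (n C 2) * (A zero j * det n (minor A j)))
    ≡⟨ *-distribˡ-altSum (suc n) (c ^ n * c ^ (n C 2)) (λ j → A zero j * det n (minor A j)) ⟨
  c ^ n * c ^ (n C 2) * det (suc n) A
    ≡⟨ cong (_* det (suc n) A) (trans (sym (^-distribˡ-+-* c n (n C 2))) (cong (c ^_) (sym ([1+n]C2≡n+nC2 n)))) ⟩
  c ^ (suc n C 2) * det (suc n) A ∎
  where
  regroup : ∀ a x y d → + 1 * a * (x * (y * d)) ≡ x * y * (a * d)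
  regroup = solve-∀

det-zeroColumn : ∀ n (A : Matrix (suc n)) → (∀ i → A i zero ≡ + 0) → det (suc n) A ≡ + 0
det-zeroColumn zero    A col≡0 = cong (λ x → + 1 * (x * + 1) + + 0) (col≡0 zero)
det-zeroColumn (suc n) A col≡0 = altSum-zero (suc (suc n)) term≡0
  where
  term≡0 : ∀ j → A zero j * det (suc n) (minor A j) ≡ + 0
  term≡0 zero    = trans (cong (_* det (suc n) (minor A zero)) (col≡0 zero)) (*-zeroˡ (det (suc n) (minor A zero)))
  term≡0 (suc j) = trans (cong (A zero (suc j) *_) (det-zeroColumn n (minor A (suc j)) (col≡0 ∘ suc)))
                         (*-zeroʳ (A zero (suc j)))

det-lowerZeroColumn : ∀ n (A : Matrix (suc n)) → (∀ i → A (suc i) zero ≡ + 0) →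
  det (suc n) A ≡ A zero zero * det n (minor A zero)
det-lowerZeroColumn zero    A col≡0 = 1*[x*1]+0≡x*1 (A zero zero)
  where
  1*[x*1]+0≡x*1 : ∀ x → + 1 * (x * + 1) + + 0 ≡ x * + 1
  1*[x*1]+0≡x*1 = solve-∀
det-lowerZeroColumn (suc n) A col≡0 = begin
  + 1 * (A zero zero * det (suc n) (minor A zero))
    + sumFin (suc n) (λ j → sign (suc j) * (A zero (suc j) * det (suc n) (minor A (suc j))))
    ≡⟨ cong (_+_ (+ 1 * (A zero zero * det (suc n) (minor A zero)))) (sumFin-zero (suc n) (λ j →
         trans (cong (sign (suc j) *_) (trans (cong (A zero (suc j) *_) (det-zeroColumn n (minor A (suc j)) col≡0))
                                               (*-zeroʳ (A zero (suc j)))))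
               (*-zeroʳ (sign (suc j))))) ⟩
  + 1 * (A zero zero * det (suc n) (minor A zero)) + + 0
    ≡⟨ 1*x+0≡x (A zero zero * det (suc n) (minor A zero)) ⟩
  A zero zero * det (suc n) (minor A zero) ∎
  where
  1*x+0≡x : ∀ x → + 1 * x + + 0 ≡ x
  1*x+0≡x = solve-∀

det-tridiagonalExpansion : ∀ n (T : Matrix (suc (suc n))) →
  (∀ j → T zero (suc (suc j)) ≡ + 0) → (∀ i → T (suc (suc i)) zero ≡ + 0) →
  det (suc (suc n)) T ≡ T zero zero * det (suc n) (minor T zero)
                        - T zero (suc zero) * T (suc zero) zero * det n (λ i j → T (suc (suc i)) (suc (suc j)))
det-tridiagonalExpansion n T row≡0 col≡0 = begin
  + 1 * (T zero zero * D₁) + (- + 1 * + 1 * (T zero (suc zero) * det (suc n) (minor T (suc zero))) + rest)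
    ≡⟨ cong₂ (λ x y → + 1 * (T zero zero * D₁) + (- + 1 * + 1 * (T zero (suc zero) * x) + y))
         (det-lowerZeroColumn n (minor T (suc zero)) col≡0)
         (sumFin-zero n (λ j → trans (cong (sign (suc (suc j)) *_) (trans (cong (_* det (suc n) (minor T (suc (suc j)))) (row≡0 j)) (*-zeroˡ (det (suc n) (minor T (suc (suc j)))))))
                                     (*-zeroʳ (sign (suc (suc j)))))) ⟩
  + 1 * (T zero zero * D₁) + (- + 1 * + 1 * (T zero (suc zero) * (T (suc zero) zero * D₂)) + + 0)
    ≡⟨ normalise (T zero zero) D₁ (T zero (suc zero)) (T (suc zero) zero) D₂ ⟩
  T zero zero * D₁ - T zero (suc zero) * T (suc zero) zero * D₂ ∎
  where
  D₁ = det (suc n) (minor T zero)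
  D₂ = det n (λ i j → T (suc (suc i)) (suc (suc j)))
  rest = sumFin n (λ j → sign (suc (suc j)) * (T zero (suc (suc j)) * det (suc n) (minor T (suc (suc j)))))
  normalise : ∀ a d₁ b c d₂ → + 1 * (a * d₁) + (- + 1 * + 1 * (b * (c * d₂)) + + 0) ≡ a * d₁ - b * c * d₂
  normalise = solve-∀

restrict : ∀ n → (ℕ → ℕ → ℤ) → Matrix (suc n)
restrict n A i j = A (toℕ i) (toℕ j)

det-restrict-lowerUnitriangular : ∀ n (T A B : ℕ → ℕ → ℤ) → (∀ i → T i i ≡ + 1) → (∀ i k → i < k → T i k ≡ + 0) →
  (∀ i j → i ≤ n → j ≤ n → B i j ≡ sumTo n (λ k → T i k * A k j)) → det (suc n) (restrict n B) ≡ det (suc n) (restrict n A)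
det-restrict-lowerUnitriangular n T A B Tii≡1 T-lower B≡TA =
  det-lowerUnitriangular (suc n) (restrict n T) (restrict n A) (restrict n B) (Tii≡1 ∘ toℕ) (λ i k → T-lower (toℕ i) (toℕ k))
    (λ i j → trans (B≡TA (toℕ i) (toℕ j) (toℕ≤n i) (toℕ≤n j)) (sym (sumFin-toℕ n (λ k → T (toℕ i) k * A k (toℕ j)))))
  where
  toℕ≤n : ∀ (i : Fin (suc n)) → toℕ i ≤ n
  toℕ≤n i = ℕ.≤-pred (Fin.toℕ<n i)

-- Tridiagonal matrices

tridiagonal : (d₀ a b c : ℤ) → ℕ → ℕ → ℤ
tridiagonal d₀ a b c zero          zero          = d₀
tridiagonal d₀ a b c zero          (suc zero)    = c
tridiagonal d₀ a b c zero          (suc (suc _)) = + 0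
tridiagonal d₀ a b c (suc i)       (suc j)       = tridiagonal b a b c i j
tridiagonal d₀ a b c (suc zero)    zero          = a
tridiagonal d₀ a b c (suc (suc _)) zero          = + 0

tridiagonal-diagonal : ∀ d₀ a b c l → tridiagonal d₀ a b c (suc l) (suc l) ≡ b
tridiagonal-diagonal d₀ a b c zero    = refl
tridiagonal-diagonal d₀ a b c (suc l) = tridiagonal-diagonal b a b c l

tridiagonalDet : (d₀ a b c : ℤ) → ℕ → ℤ
tridiagonalDet d₀ a b c n = det n (λ i j → tridiagonal d₀ a b c (toℕ i) (toℕ j))

tridiagonalDet-1 : ∀ d₀ a b c → tridiagonalDet d₀ a b c 1 ≡ d₀
tridiagonalDet-1 d₀ a b c = 1*[x*1]+0≡x d₀
  where
  1*[x*1]+0≡x : ∀ x → + 1 * (x * + 1) + + 0 ≡ x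
  1*[x*1]+0≡x = solve-∀

tridiagonalDet-expand : ∀ d₀ a b c n →
  tridiagonalDet d₀ a b c (suc (suc n)) ≡ d₀ * tridiagonalDet b a b c (suc n) - c * a * tridiagonalDet b a b c n
tridiagonalDet-expand d₀ a b c n =
  det-tridiagonalExpansion n (λ i j → tridiagonal d₀ a b c (toℕ i) (toℕ j)) (λ _ → refl) (λ _ → refl)

tridiagonal-rowSum : ∀ d₀ a b c n l (u : ℕ → ℤ) → l ≤ n → u (suc n) ≡ + 0 →
  sumTo n (λ k → u k * tridiagonal d₀ a b c l k) ≡ a * prev u l + tridiagonal d₀ a b c l l * u l + c * u (suc l)
tridiagonal-rowSum d₀ a b c zero zero u _ u₁≡0 = begin
  u 0 * d₀                           ≡⟨ normalise a c d₀ (u 0) ⟩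
  a * + 0 + d₀ * u 0 + c * + 0       ≡⟨ cong (λ x → a * + 0 + d₀ * u 0 + c * x) u₁≡0 ⟨
  a * + 0 + d₀ * u 0 + c * u 1       ∎
  where
  normalise : ∀ a c d₀ x → x * d₀ ≡ a * + 0 + d₀ * x + c * + 0
  normalise = solve-∀
tridiagonal-rowSum d₀ a b c (suc n) zero u _ _ = begin
  sumTo (suc n) (λ k → u k * tridiagonal d₀ a b c 0 k)
    ≡⟨ sumTo-shift n (λ k → u k * tridiagonal d₀ a b c 0 k) ⟩
  u 0 * d₀ + sumTo n (λ k → u (suc k) * tridiagonal d₀ a b c 0 (suc k))
    ≡⟨ cong (_+_ (u 0 * d₀)) (sumTo-first n _ (λ k → *-zeroʳ (u (suc (suc k))))) ⟩
  u 0 * d₀ + u 1 * c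
    ≡⟨ normalise a c d₀ (u 0) (u 1) ⟩
  a * + 0 + d₀ * u 0 + c * u 1 ∎
  where
  normalise : ∀ a c d₀ x y → x * d₀ + y * c ≡ a * + 0 + d₀ * x + c * y
  normalise = solve-∀
tridiagonal-rowSum d₀ a b c (suc n) (suc l) u (s≤s l≤n) u≡0 = begin
  sumTo (suc n) (λ k → u k * tridiagonal d₀ a b c (suc l) k)
    ≡⟨ sumTo-shift n (λ k → u k * tridiagonal d₀ a b c (suc l) k) ⟩
  u 0 * tridiagonal d₀ a b c (suc l) 0 + sumTo n (λ k → u (suc k) * tridiagonal b a b c l k)
    ≡⟨ cong (_+_ (u 0 * tridiagonal d₀ a b c (suc l) 0)) (tridiagonal-rowSum b a b c n l (u ∘ suc) l≤n u≡0) ⟩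
  u 0 * tridiagonal d₀ a b c (suc l) 0 + (a * prev (u ∘ suc) l + X₁ + X₂)
    ≡⟨ subdiagonal l ⟩
  a * u l + X₁ + X₂ ∎
  where
  X₁ = tridiagonal b a b c l l * u (suc l)
  X₂ = c * u (suc (suc l))
  subdiagonal : ∀ l → u 0 * tridiagonal d₀ a b c (suc l) 0 + (a * prev (u ∘ suc) l + X₁ + X₂) ≡ a * prev u (suc l) + X₁ + X₂
  subdiagonal zero    = normalise a (u 0) X₁ X₂
    where
    normalise : ∀ a x y z → x * a + (a * + 0 + y + z) ≡ a * x + y + z
    normalise = solve-∀
  subdiagonal (suc l) = normalise a (u 0) (u (suc l)) X₁ X₂
    where
    normalise : ∀ a x y z w → x * + 0 + (a * y + z + w) ≡ a * y + z + w
    normalise = solve-∀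

-- Linear recurrences of order two

Recurrence : ℤ → ℤ → (ℕ → ℤ) → Set
Recurrence p q u = ∀ m → u (suc (suc m)) ≡ p * u (suc m) + q * u m

Recurrence-unique : ∀ p q {u v : ℕ → ℤ} → Recurrence p q u → Recurrence p q v → u 0 ≡ v 0 → u 1 ≡ v 1 → u ≗ v
Recurrence-unique p q {u} {v} ru rv u₀≡v₀ u₁≡v₁ = unique
  where
  unique : u ≗ v
  unique zero          = u₀≡v₀
  unique (suc zero)    = u₁≡v₁
  unique (suc (suc m)) = trans (ru m) (trans (cong₂ (λ x y → p * x + q * y) (unique (suc m)) (unique m)) (sym (rv m)))

Recurrence-difference : ∀ p q {u : ℕ → ℤ} → Recurrence p q u → Recurrence p q (λ m → u (suc m) - u m)
Recurrence-difference p q {u} ru m =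
  trans (cong₂ _-_ (ru (suc m)) (ru m)) (regroup p q (u (suc (suc m))) (u (suc m)) (u m))
  where
  regroup : ∀ p q x y z → p * x + q * y - (p * y + q * z) ≡ p * (x - y) + q * (y - z)
  regroup = solve-∀

binomialTransform : (ℕ → ℤ) → ℕ → ℤ
binomialTransform u m = sumTo m (λ k → binom m k * u k)

binomialTransform-suc : ∀ (u : ℕ → ℤ) m →
  binomialTransform u (suc m) ≡ binomialTransform u m + binomialTransform (u ∘ suc) m
binomialTransform-suc u m = begin
  sumTo (suc m) (λ k → binom (suc m) k * u k)
    ≡⟨ sumTo-cong (suc m) (λ k → trans (cong (_* u k) (binom-suc m k)) (*-distribʳ-+ (u k) (binom m k) (prev (binom m) k))) ⟩
  sumTo (suc m) (λ k → binom m k * u k + prev (binom m) k * u k)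
    ≡⟨ sumTo-distrib-+ (suc m) (λ k → binom m k * u k) (λ k → prev (binom m) k * u k) ⟩
  binomialTransform u m + binom m (suc m) * u (suc m) + sumTo (suc m) (λ k → prev (binom m) k * u k)
    ≡⟨ cong₂ _+_ (cong (λ x → binomialTransform u m + x * u (suc m)) (binom-vanish (ℕ.n<1+n m)))
                 (sumTo-shift m (λ k → prev (binom m) k * u k)) ⟩
  binomialTransform u m + + 0 * u (suc m) + (+ 0 * u 0 + binomialTransform (u ∘ suc) m)
    ≡⟨ drop-zeros (binomialTransform u m) (u (suc m)) (u 0) _ ⟩
  binomialTransform u m + binomialTransform (u ∘ suc) m ∎
  where
  drop-zeros : ∀ x y z w → x + + 0 * y + (+ 0 * z + w) ≡ x + w
  drop-zeros = solve-∀

binomialTransform-linear : ∀ x y (u v : ℕ → ℤ) m →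
  binomialTransform (λ k → x * u k + y * v k) m ≡ x * binomialTransform u m + y * binomialTransform v m
binomialTransform-linear x y u v m = begin
  sumTo m (λ k → binom m k * (x * u k + y * v k))
    ≡⟨ sumTo-cong m (λ k → distribute (binom m k) x y (u k) (v k)) ⟩
  sumTo m (λ k → x * (binom m k * u k) + y * (binom m k * v k))
    ≡⟨ sumTo-distrib-+ m _ _ ⟩
  sumTo m (λ k → x * (binom m k * u k)) + sumTo m (λ k → y * (binom m k * v k))
    ≡⟨ cong₂ _+_ (*-distribˡ-sumTo m x _) (*-distribˡ-sumTo m y _) ⟨
  x * binomialTransform u m + y * binomialTransform v m ∎
  where
  distribute : ∀ c x y a b → c * (x * a + y * b) ≡ x * (c * a) + y * (c * b)
  distribute = solve-∀

-- In terms of the shift E, the binomial transform is (1 + E)^m, and E² = pE + q gives (1 + E)² = (p + 2)(1 + E) + (q - p - 1).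
binomialTransform-recurrence : ∀ p q {u : ℕ → ℤ} → Recurrence p q u → Recurrence (p + + 2) (q - p - + 1) (binomialTransform u)
binomialTransform-recurrence p q {u} ru m = begin
  binomialTransform u (suc (suc m))
    ≡⟨ binomialTransform-suc u (suc m) ⟩
  binomialTransform u (suc m) + binomialTransform (u ∘ suc) (suc m)
    ≡⟨ cong₂ _+_ (binomialTransform-suc u m) (binomialTransform-suc (u ∘ suc) m) ⟩
  (X + Y) + (Y + binomialTransform (λ k → u (suc (suc k))) m)
    ≡⟨ cong (λ z → (X + Y) + (Y + z)) (trans (sumTo-cong m (λ k → cong (binom m k *_) (ru k)))
                                              (binomialTransform-linear p q (u ∘ suc) u m)) ⟩
  (X + Y) + (Y + (p * Y + q * X))
    ≡⟨ regroup p q X Y ⟩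
  (p + + 2) * (X + Y) + (q - p - + 1) * X
    ≡⟨ cong (λ z → (p + + 2) * z + (q - p - + 1) * X) (binomialTransform-suc u m) ⟨
  (p + + 2) * binomialTransform u (suc m) + (q - p - + 1) * binomialTransform u m ∎
  where
  X = binomialTransform u m
  Y = binomialTransform (u ∘ suc) m
  regroup : ∀ p q x y → (x + y) + (y + (p * y + q * x)) ≡ (p + + 2) * (x + y) + (q - p - + 1) * x
  regroup = solve-∀

-- Fibonacci polynomials

module _ (α β : ℤ) where

  fibTerm : ℕ → ℕ → ℤ
  fibTerm m k = binom (m ∸ k) k * β ^ k * α ^ (m ∸ 2 *ℕ k)

  fibPoly : ℕ → ℤ
  fibPoly m = sumTo m (fibTerm m)

  private
    2*suc : ∀ k → 2 *ℕ suc k ≡ suc (suc (2 *ℕ k))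
    2*suc k = ℕ.*-suc 2 k

    [k+p]∸2k≡p∸k : ∀ k p → (k +ℕ p) ∸ 2 *ℕ k ≡ p ∸ k
    [k+p]∸2k≡p∸k k p = trans (ℕ.[m+n]∸[m+o]≡n∸o k p (k +ℕ 0)) (cong (p ∸_) (ℕ.+-identityʳ k))

  fibTerm-vanish : ∀ m k → m ≤ suc k → fibTerm m (suc k) ≡ + 0
  fibTerm-vanish m k m≤1+k = begin
    binom (m ∸ suc k) (suc k) * β ^ suc k * α ^ (m ∸ 2 *ℕ suc k)
      ≡⟨ cong (λ x → binom x (suc k) * β ^ suc k * α ^ (m ∸ 2 *ℕ suc k)) (ℕ.m≤n⇒m∸n≡0 m≤1+k) ⟩
    + 0 * β ^ suc k * α ^ (m ∸ 2 *ℕ suc k)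
      ≡⟨ cong (_* α ^ (m ∸ 2 *ℕ suc k)) (*-zeroˡ (β ^ suc k)) ⟩
    + 0 * α ^ (m ∸ 2 *ℕ suc k)
      ≡⟨ *-zeroˡ (α ^ (m ∸ 2 *ℕ suc k)) ⟩
    + 0 ∎

  pascal-weighted : ∀ k p → (binom p (suc k) + binom p k) * β ^ suc k * α ^ (p ∸ k)
    ≡ β * (binom p k * β ^ k * α ^ (p ∸ k)) + α * (binom p (suc k) * β ^ suc k * α ^ (p ∸ suc k))
  pascal-weighted k p with ℕ.≤-<-connex p k
  ... | inj₁ p≤k = begin
    (binom p (suc k) + binom p k) * β ^ suc k * α ^ (p ∸ k)
      ≡⟨ cong (λ x → (x + binom p k) * β ^ suc k * α ^ (p ∸ k)) b≡0 ⟩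
    (+ 0 + binom p k) * β ^ suc k * α ^ (p ∸ k)
      ≡⟨ normalise α β (binom p k) (β ^ k) (α ^ (p ∸ k)) (α ^ (p ∸ suc k)) ⟩
    β * (binom p k * β ^ k * α ^ (p ∸ k)) + α * (+ 0 * β ^ suc k * α ^ (p ∸ suc k))
      ≡⟨ cong (λ x → β * (binom p k * β ^ k * α ^ (p ∸ k)) + α * (x * β ^ suc k * α ^ (p ∸ suc k))) b≡0 ⟨
    β * (binom p k * β ^ k * α ^ (p ∸ k)) + α * (binom p (suc k) * β ^ suc k * α ^ (p ∸ suc k)) ∎
    where
    b≡0 : binom p (suc k) ≡ + 0
    b≡0 = binom-vanish (s≤s p≤k)
    normalise : ∀ α β b y x x′ → (+ 0 + b) * (β * y) * x ≡ β * (b * y * x) + α * (+ 0 * (β * y) * x′)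
    normalise = solve-∀
  ... | inj₂ k<p = begin
    (binom p (suc k) + binom p k) * β ^ suc k * α ^ (p ∸ k)
      ≡⟨ cong (λ x → (binom p (suc k) + binom p k) * β ^ suc k * α ^ x) e ⟩
    (binom p (suc k) + binom p k) * β ^ suc k * α ^ suc (p ∸ suc k)
      ≡⟨ normalise α β (binom p k) (binom p (suc k)) (β ^ k) (α ^ (p ∸ suc k)) ⟩
    β * (binom p k * β ^ k * α ^ suc (p ∸ suc k)) + α * (binom p (suc k) * β ^ suc k * α ^ (p ∸ suc k))
      ≡⟨ cong (λ x → β * (binom p k * β ^ k * α ^ x) + α * (binom p (suc k) * β ^ suc k * α ^ (p ∸ suc k))) e ⟨
    β * (binom p k * β ^ k * α ^ (p ∸ k)) + α * (binom p (suc k) * β ^ suc k * α ^ (p ∸ suc k)) ∎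
    where
    e : p ∸ k ≡ suc (p ∸ suc k)
    e = ℕ.+-∸-assoc 1 k<p
    normalise : ∀ α β b b′ y x → (b′ + b) * (β * y) * (α * x) ≡ β * (b * y * (α * x)) + α * (b′ * (β * y) * x)
    normalise = solve-∀

  fibTerm-step-+ : ∀ k p → fibTerm (suc (suc (k +ℕ p))) (suc k) ≡ β * fibTerm (k +ℕ p) k + α * fibTerm (suc (k +ℕ p)) (suc k)
  fibTerm-step-+ k p = begin
    binom (suc (k +ℕ p) ∸ k) (suc k) * β ^ suc k * α ^ (suc (suc (k +ℕ p)) ∸ 2 *ℕ suc k)
      ≡⟨ cong₂ (λ x y → binom x (suc k) * β ^ suc k * α ^ y) top₁ exp₁ ⟩
    binom (suc p) (suc k) * β ^ suc k * α ^ (p ∸ k)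
      ≡⟨ cong (λ x → x * β ^ suc k * α ^ (p ∸ k)) (binom-suc p (suc k)) ⟩
    (binom p (suc k) + binom p k) * β ^ suc k * α ^ (p ∸ k)
      ≡⟨ pascal-weighted k p ⟩
    β * (binom p k * β ^ k * α ^ (p ∸ k)) + α * (binom p (suc k) * β ^ suc k * α ^ (p ∸ suc k))
      ≡⟨ cong₂ (λ x y → β * x + α * y) term₀ term₁ ⟨
    β * fibTerm (k +ℕ p) k + α * fibTerm (suc (k +ℕ p)) (suc k) ∎
    where
    top₁ : suc (k +ℕ p) ∸ k ≡ suc p
    top₁ = trans (cong (_∸ k) (sym (ℕ.+-suc k p))) (ℕ.m+n∸m≡n k (suc p))
    exp₁ : suc (suc (k +ℕ p)) ∸ 2 *ℕ suc k ≡ p ∸ k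
    exp₁ = trans (cong (suc (suc (k +ℕ p)) ∸_) (2*suc k)) ([k+p]∸2k≡p∸k k p)
    term₀ : fibTerm (k +ℕ p) k ≡ binom p k * β ^ k * α ^ (p ∸ k)
    term₀ = cong₂ (λ x y → binom x k * β ^ k * α ^ y) (ℕ.m+n∸m≡n k p) ([k+p]∸2k≡p∸k k p)
    term₁ : fibTerm (suc (k +ℕ p)) (suc k) ≡ binom p (suc k) * β ^ suc k * α ^ (p ∸ suc k)
    term₁ = cong₂ (λ x y → binom x (suc k) * β ^ suc k * α ^ y) (ℕ.m+n∸m≡n k p) (begin
      suc (k +ℕ p) ∸ 2 *ℕ suc k        ≡⟨ cong (suc (k +ℕ p) ∸_) (2*suc k) ⟩
      (k +ℕ p) ∸ suc (2 *ℕ k)          ≡⟨ ℕ.pred[m∸n]≡m∸[1+n] (k +ℕ p) (2 *ℕ k) ⟨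
      pred ((k +ℕ p) ∸ 2 *ℕ k)       ≡⟨ cong pred ([k+p]∸2k≡p∸k k p) ⟩
      pred (p ∸ k)                   ≡⟨ ℕ.pred[m∸n]≡m∸[1+n] p k ⟩
      p ∸ suc k                        ∎)
  fibTerm-step : ∀ m k → fibTerm (suc (suc m)) (suc k) ≡ β * fibTerm m k + α * fibTerm (suc m) (suc k)
  fibTerm-step m k with ℕ.≤-<-connex k m
  ... | inj₁ k≤m = subst (λ x → fibTerm (suc (suc x)) (suc k) ≡ β * fibTerm x k + α * fibTerm (suc x) (suc k))
                         (ℕ.m+[n∸m]≡n k≤m) (fibTerm-step-+ k (m ∸ k))
  ... | inj₂ m<k@(s≤s _) = begin
    fibTerm (suc (suc m)) (suc k)                 ≡⟨ fibTerm-vanish (suc (suc m)) k (s≤s m<k) ⟩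
    + 0                                           ≡⟨ β*0+α*0≡0 α β ⟨
    β * + 0 + α * + 0                             ≡⟨ cong₂ (λ x y → β * x + α * y) (fibTerm-vanish m _ (ℕ.<⇒≤ m<k))
                                                                                   (fibTerm-vanish (suc m) k (ℕ.m≤n⇒m≤1+n m<k)) ⟨
    β * fibTerm m k + α * fibTerm (suc m) (suc k) ∎
    where
    β*0+α*0≡0 : ∀ α β → β * + 0 + α * + 0 ≡ + 0
    β*0+α*0≡0 = solve-∀

  fibPoly-recurrence : Recurrence α β fibPoly
  fibPoly-recurrence m = begin
    fibPoly (suc (suc m))
      ≡⟨ sumTo-shift (suc m) (fibTerm (suc (suc m))) ⟩
    fibTerm (suc (suc m)) 0 + sumTo (suc m) (λ k → fibTerm (suc (suc m)) (suc k))
      ≡⟨ cong (_+_ (fibTerm (suc (suc m)) 0)) (begin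
           sumTo (suc m) (λ k → fibTerm (suc (suc m)) (suc k))
             ≡⟨ sumTo-cong (suc m) (fibTerm-step m) ⟩
           sumTo (suc m) (λ k → β * fibTerm m k + α * fibTerm (suc m) (suc k))
             ≡⟨ sumTo-distrib-+ (suc m) _ _ ⟩
           sumTo (suc m) (λ k → β * fibTerm m k) + sumTo (suc m) (λ k → α * fibTerm (suc m) (suc k))
             ≡⟨ cong₂ _+_ (*-distribˡ-sumTo (suc m) β (fibTerm m)) (*-distribˡ-sumTo (suc m) α (λ k → fibTerm (suc m) (suc k))) ⟨
           β * (fibPoly m + fibTerm m (suc m)) + α * (sumTo m (λ k → fibTerm (suc m) (suc k)) + fibTerm (suc m) (suc (suc m)))
             ≡⟨ cong₂ (λ x y → β * (fibPoly m + x) + α * (sumTo m (λ k → fibTerm (suc m) (suc k)) + y))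
                      (fibTerm-vanish m m (ℕ.n≤1+n m)) (fibTerm-vanish (suc m) (suc m) (ℕ.n≤1+n (suc m))) ⟩
           β * (fibPoly m + + 0) + α * (sumTo m (λ k → fibTerm (suc m) (suc k)) + + 0) ∎) ⟩
    + 1 * + 1 * (α * α ^ suc m) + (β * (fibPoly m + + 0) + α * (S + + 0))
      ≡⟨ regroup α β (α ^ suc m) (fibPoly m) S ⟩
    α * (+ 1 * + 1 * α ^ suc m + S) + β * fibPoly m
      ≡⟨ cong (λ x → α * x + β * fibPoly m) (sumTo-shift m (fibTerm (suc m))) ⟨
    α * fibPoly (suc m) + β * fibPoly m ∎
    where
    S = sumTo m (λ k → fibTerm (suc m) (suc k))
    regroup : ∀ α β a x y → + 1 * + 1 * (α * a) + (β * (x + + 0) + α * (y + + 0)) ≡ α * (+ 1 * + 1 * a + y) + β * x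
    regroup = solve-∀

  fibPoly-1 : fibPoly 1 ≡ α
  fibPoly-1 = normalise α β
    where
    normalise : ∀ α β → + 1 * + 1 * (α * + 1) + + 0 * (β * + 1) * + 1 ≡ α
    normalise = solve-∀

  fibPoly-half : ∀ m → sumTo ⌊ m /2⌋ (fibTerm m) ≡ fibPoly m
  fibPoly-half m = sumTo-extend ⌊ m /2⌋ m (fibTerm m) (ℕ.⌊n/2⌋≤n m) vanish
    where
    vanish : ∀ k → ⌊ m /2⌋ < k → fibTerm m k ≡ + 0
    vanish (suc k) ⌊m/2⌋<1+k = begin
      binom (m ∸ suc k) (suc k) * β ^ suc k * α ^ (m ∸ 2 *ℕ suc k)
        ≡⟨ cong (λ x → x * β ^ suc k * α ^ (m ∸ 2 *ℕ suc k)) (binom-vanish (ℕ.m<n+o⇒m∸n<o m (suc k) m<2k)) ⟩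
      + 0 * β ^ suc k * α ^ (m ∸ 2 *ℕ suc k)
        ≡⟨ cong (_* α ^ (m ∸ 2 *ℕ suc k)) (*-zeroˡ (β ^ suc k)) ⟩
      + 0 * α ^ (m ∸ 2 *ℕ suc k)
        ≡⟨ *-zeroˡ (α ^ (m ∸ 2 *ℕ suc k)) ⟩
      + 0 ∎
      where
      m<2k : m < suc k +ℕ suc k
      m<2k = ℕ.≰⇒> (λ 2k≤m → ℕ.<⇒≱ ⌊m/2⌋<1+k (subst (_≤ ⌊ m /2⌋) (sym (ℕ.n≡⌊n+n/2⌋ (suc k))) (ℕ.⌊n/2⌋-mono 2k≤m)))

  fibPoly-reverse : ∀ m → sumTo m (λ k → binom k (m ∸ k) * α ^ (2 *ℕ k ∸ m) * β ^ (m ∸ k)) ≡ fibPoly m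
  fibPoly-reverse m = trans (sumTo-reverse m _) (sumTo-cong-≤ m (λ k k≤m →
    trans (cong₂ (λ x y → binom (m ∸ k) x * α ^ y * β ^ x) (ℕ.m∸[m∸n]≡n k≤m) (exponent k≤m))
          (swap (binom (m ∸ k) k) (α ^ (m ∸ 2 *ℕ k)) (β ^ k))))
    where
    swap : ∀ b a c → b * a * c ≡ b * c * a
    swap = solve-∀
    exponent : ∀ {k} → k ≤ m → 2 *ℕ (m ∸ k) ∸ m ≡ m ∸ 2 *ℕ k
    exponent {k} k≤m = subst (λ x → 2 *ℕ (x ∸ k) ∸ x ≡ x ∸ 2 *ℕ k) (ℕ.m+[n∸m]≡n k≤m) (begin
      2 *ℕ (k +ℕ p ∸ k) ∸ (k +ℕ p)   ≡⟨ cong (λ x → 2 *ℕ x ∸ (k +ℕ p)) (ℕ.m+n∸m≡n k p) ⟩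
      (p +ℕ (p +ℕ 0)) ∸ (k +ℕ p)     ≡⟨ cong (p +ℕ (p +ℕ 0) ∸_) (ℕ.+-comm k p) ⟩
      (p +ℕ (p +ℕ 0)) ∸ (p +ℕ k)     ≡⟨ ℕ.[m+n]∸[m+o]≡n∸o p (p +ℕ 0) k ⟩
      (p +ℕ 0) ∸ k                   ≡⟨ cong (_∸ k) (ℕ.+-identityʳ p) ⟩
      p ∸ k                          ≡⟨ [k+p]∸2k≡p∸k k p ⟨
      k +ℕ p ∸ 2 *ℕ k                ∎)
      where
      p = m ∸ k

fibPoly-half-β≡1 : ∀ α m → sumTo ⌊ m /2⌋ (λ j → binom (m ∸ j) j * α ^ (m ∸ 2 *ℕ j)) ≡ fibPoly α (+ 1) m
fibPoly-half-β≡1 α m = trans (sumTo-cong ⌊ m /2⌋ (λ j → cong (_* α ^ (m ∸ 2 *ℕ j)) (sym (b*1^j≡b (binom (m ∸ j) j) j))))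
                             (fibPoly-half α (+ 1) m)
  where
  b*1^j≡b : ∀ b j → b * (+ 1) ^ j ≡ b
  b*1^j≡b b j = trans (cong (b *_) (^-zeroˡ j)) (*-identityʳ b)

fibPoly-reverse-β≡1 : ∀ α m → sumTo m (λ j → binom j (m ∸ j) * α ^ (2 *ℕ j ∸ m)) ≡ fibPoly α (+ 1) m
fibPoly-reverse-β≡1 α m = trans (sumTo-cong m (λ j → sym (x*1^j≡x (binom j (m ∸ j) * α ^ (2 *ℕ j ∸ m)) (m ∸ j))))
                                (fibPoly-reverse α (+ 1) m)
  where
  x*1^j≡x : ∀ x j → x * (+ 1) ^ j ≡ x
  x*1^j≡x x j = trans (cong (x *_) (^-zeroˡ j)) (*-identityʳ x)

-- Moments of a Jacobi continued fraction

-- motzkin n k is the weighted count of Motzkin paths of length n from height 0 to height k, with up steps of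
-- weight 1, level steps of weight b₀ at height 0 and b above, and down steps of weight c.
module Moments (b₀ b c : ℤ) where

  step : (ℕ → ℤ) → ℕ → ℤ
  step u zero    = b₀ * u 0 + c * u 1
  step u (suc k) = u k + b * u (suc k) + c * u (suc (suc k))

  motzkin : ℕ → ℕ → ℤ
  motzkin zero    zero    = + 1
  motzkin zero    (suc k) = + 0
  motzkin (suc n) k       = step (motzkin n) k

  moment : ℕ → ℤ
  moment n = motzkin n 0

  motzkin-above : ∀ {n k} → n < k → motzkin n k ≡ + 0
  motzkin-above {zero}  {suc k} _         = refl
  motzkin-above {suc n} {suc k} (s≤s n<k) = begin
    motzkin n k + b * motzkin n (suc k) + c * motzkin n (suc (suc k))
      ≡⟨ cong₂ _+_ (cong₂ (λ x y → x + b * y) (motzkin-above n<k) (motzkin-above (ℕ.m<n⇒m<1+n n<k)))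
                   (cong (c *_) (motzkin-above (ℕ.m<n⇒m<1+n (ℕ.m<n⇒m<1+n n<k)))) ⟩
    + 0 + b * + 0 + c * + 0
      ≡⟨ normalise b c ⟩
    + 0 ∎
    where
    normalise : ∀ b c → + 0 + b * + 0 + c * + 0 ≡ + 0
    normalise = solve-∀

  motzkin-diagonal : ∀ n → motzkin n n ≡ + 1
  motzkin-diagonal zero    = refl
  motzkin-diagonal (suc n) = begin
    motzkin n n + b * motzkin n (suc n) + c * motzkin n (suc (suc n))
      ≡⟨ cong₂ _+_ (cong₂ (λ x y → x + b * y) (motzkin-diagonal n) (motzkin-above (ℕ.n<1+n n)))
                   (cong (c *_) (motzkin-above (ℕ.m<n⇒m<1+n (ℕ.n<1+n n)))) ⟩
    + 1 + b * + 0 + c * + 0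
      ≡⟨ normalise b c ⟩
    + 1 ∎
    where
    normalise : ∀ b c → + 1 + b * + 0 + c * + 0 ≡ + 1
    normalise = solve-∀

  adjointStep : (ℕ → ℤ) → ℕ → ℤ
  adjointStep x zero    = x 1 + b₀ * x 0
  adjointStep x (suc m) = x (suc (suc m)) + b * x (suc m) + c * x m

  sumTo-step : ∀ N (u x : ℕ → ℤ) → sumTo N (λ k → step u k * x k)
    ≡ sumTo N (λ m → u m * adjointStep x m) + (c * u (suc N) * x N - u N * x (suc N))
  sumTo-step zero    u x = normalise b₀ c (u 0) (u 1) (x 0) (x 1)
    where
    normalise : ∀ b₀ c u₀ u₁ x₀ x₁ → (b₀ * u₀ + c * u₁) * x₀ ≡ u₀ * (x₁ + b₀ * x₀) + (c * u₁ * x₀ - u₀ * x₁)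
    normalise = solve-∀
  sumTo-step (suc N) u x = trans (cong (_+ step u (suc N) * x (suc N)) (sumTo-step N u x))
    (normalise b c (sumTo N (λ m → u m * adjointStep x m)) (u N) (u (suc N)) (u (suc (suc N))) (x N) (x (suc N)) (x (suc (suc N))))
    where
    normalise : ∀ b c s u₀ u₁ u₂ x₀ x₁ x₂ →
      s + (c * u₁ * x₀ - u₀ * x₁) + (u₀ + b * u₁ + c * u₂) * x₁ ≡ s + u₁ * (x₂ + b * x₁ + c * x₀) + (c * u₂ * x₁ - u₁ * x₂)
    normalise = solve-∀

  -- The weights c ^ k make the step symmetric: diag(c ^ k) · step = stepᵀ · diag(c ^ k).
  adjointStep-weighted : ∀ j m → adjointStep (λ k → motzkin j k * c ^ k) m ≡ motzkin (suc j) m * c ^ m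
  adjointStep-weighted j zero    = normalise b₀ c (motzkin j 0) (motzkin j 1)
    where
    normalise : ∀ b₀ c x y → y * (c * + 1) + b₀ * (x * + 1) ≡ (b₀ * x + c * y) * + 1
    normalise = solve-∀
  adjointStep-weighted j (suc m) = normalise b c (motzkin j m) (motzkin j (suc m)) (motzkin j (suc (suc m))) (c ^ m)
    where
    normalise : ∀ b c x y z p → z * (c * (c * p)) + b * (y * (c * p)) + c * (x * p) ≡ (x + b * y + c * z) * (c * p)
    normalise = solve-∀

  moment-+ : ∀ i j N → i ≤ N → sumTo N (λ k → motzkin i k * (motzkin j k * c ^ k)) ≡ moment (i +ℕ j)
  moment-+ zero    j N _ = trans (sumTo-first N _ (λ k → *-zeroˡ (motzkin j (suc k) * c ^ suc k))) (1*[x*1]≡x (motzkin j 0))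
    where
    1*[x*1]≡x : ∀ x → + 1 * (x * + 1) ≡ x
    1*[x*1]≡x = solve-∀
  moment-+ (suc i) j N i<N = begin
    sumTo N (λ k → step (motzkin i) k * (motzkin j k * c ^ k))
      ≡⟨ sumTo-step N (motzkin i) (λ k → motzkin j k * c ^ k) ⟩
    sumTo N (λ m → motzkin i m * adjointStep (λ k → motzkin j k * c ^ k) m) + boundary
      ≡⟨ cong₂ _+_ (sumTo-cong N (λ m → cong (motzkin i m *_) (adjointStep-weighted j m))) boundary≡0 ⟩
    sumTo N (λ m → motzkin i m * (motzkin (suc j) m * c ^ m)) + + 0
      ≡⟨ +-identityʳ _ ⟩
    sumTo N (λ m → motzkin i m * (motzkin (suc j) m * c ^ m))
      ≡⟨ moment-+ i (suc j) N (ℕ.<⇒≤ i<N) ⟩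
    moment (i +ℕ suc j)
      ≡⟨ cong moment (ℕ.+-suc i j) ⟩
    moment (suc i +ℕ j) ∎
    where
    boundary = c * motzkin i (suc N) * (motzkin j N * c ^ N) - motzkin i N * (motzkin j (suc N) * c ^ suc N)
    boundary≡0 : boundary ≡ + 0
    boundary≡0 = trans (cong₂ (λ x y → c * x * (motzkin j N * c ^ N) - y * (motzkin j (suc N) * c ^ suc N))
                              (motzkin-above (ℕ.m<n⇒m<1+n i<N)) (motzkin-above i<N))
                       (normalise c (motzkin j N * c ^ N) (motzkin j (suc N) * c ^ suc N))
      where
      normalise : ∀ c x y → c * + 0 * x - + 0 * y ≡ + 0
      normalise = solve-∀

  Q : ℕ → ℕ → ℤ
  Q = tridiagonal (+ 1 + b₀) (+ 1) (+ 1 + b) c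

  Q-rowSum : ∀ n j l → j ≤ n → l ≤ n → sumTo n (λ k → motzkin j k * Q l k) ≡ motzkin j l + motzkin (suc j) l
  Q-rowSum n j l j≤n l≤n =
    trans (tridiagonal-rowSum (+ 1 + b₀) (+ 1) (+ 1 + b) c n l (motzkin j) l≤n (motzkin-above (s≤s j≤n))) (row l)
    where
    row : ∀ l → + 1 * prev (motzkin j) l + Q l l * motzkin j l + c * motzkin j (suc l) ≡ motzkin j l + step (motzkin j) l
    row zero    = normalise b₀ c (motzkin j 0) (motzkin j 1)
      where
      normalise : ∀ b₀ c x y → + 1 * + 0 + (+ 1 + b₀) * x + c * y ≡ x + (b₀ * x + c * y)
      normalise = solve-∀
    row (suc l) = trans (cong (λ d → + 1 * motzkin j l + d * motzkin j (suc l) + c * motzkin j (suc (suc l)))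
                              (tridiagonal-diagonal (+ 1 + b₀) (+ 1) (+ 1 + b) c l))
                        (normalise b c (motzkin j l) (motzkin j (suc l)) (motzkin j (suc (suc l))))
      where
      normalise : ∀ b c x y z → + 1 * x + (+ 1 + b) * y + c * z ≡ y + (x + b * y + c * z)
      normalise = solve-∀

  hankel-moments : ∀ n → hankel (λ k → moment k + moment (suc k)) n ≡ c ^ (suc n C 2) * tridiagonalDet (+ 1 + b₀) (+ 1) (+ 1 + b) c (suc n)
  hankel-moments n = begin
    det (suc n) (restrict n H)              ≡⟨ det-restrict-lowerUnitriangular n motzkin N H motzkin-diagonal (λ _ _ → motzkin-above) H≡motzkin·N ⟩
    det (suc n) (restrict n N)              ≡⟨ det-transpose (suc n) (restrict n N) ⟨
    det (suc n) (restrict n (flip N))  ≡⟨ det-restrict-lowerUnitriangular n motzkin P (flip N) motzkin-diagonal (λ _ _ → motzkin-above) Nᵀ≡motzkin·P ⟩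
    det (suc n) (restrict n P)              ≡⟨ det-transpose (suc n) (restrict n P) ⟨
    det (suc n) (λ l k → c ^ toℕ l * Q (toℕ l) (toℕ k)) ≡⟨ det-scaleRows-^ (suc n) c (restrict n Q) ⟩
    c ^ (suc n C 2) * det (suc n) (restrict n Q) ∎
    where
    H N P : ℕ → ℕ → ℤ
    H i j = moment (i +ℕ j) + moment (suc (i +ℕ j))
    N k j = c ^ k * (motzkin j k + motzkin (suc j) k)
    P k l = c ^ l * Q l k
    H≡motzkin·N : ∀ i j → i ≤ n → j ≤ n → H i j ≡ sumTo n (λ k → motzkin i k * N k j)
    H≡motzkin·N i j i≤n _ = begin
      moment (i +ℕ j) + moment (suc (i +ℕ j))
        ≡⟨ cong (λ x → moment (i +ℕ j) + moment x) (ℕ.+-suc i j) ⟨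
      moment (i +ℕ j) + moment (i +ℕ suc j)
        ≡⟨ cong₂ _+_ (moment-+ i j n i≤n) (moment-+ i (suc j) n i≤n) ⟨
      sumTo n (λ k → motzkin i k * (motzkin j k * c ^ k)) + sumTo n (λ k → motzkin i k * (motzkin (suc j) k * c ^ k))
        ≡⟨ sumTo-distrib-+ n _ _ ⟨
      sumTo n (λ k → motzkin i k * (motzkin j k * c ^ k) + motzkin i k * (motzkin (suc j) k * c ^ k))
        ≡⟨ sumTo-cong n (λ k → factor (motzkin i k) (motzkin j k) (motzkin (suc j) k) (c ^ k)) ⟩
      sumTo n (λ k → motzkin i k * N k j) ∎
      where
      factor : ∀ a x y p → a * (x * p) + a * (y * p) ≡ a * (p * (x + y))
      factor = solve-∀
    Nᵀ≡motzkin·P : ∀ j l → j ≤ n → l ≤ n → N l j ≡ sumTo n (λ k → motzkin j k * P k l)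
    Nᵀ≡motzkin·P j l j≤n l≤n = begin
      c ^ l * (motzkin j l + motzkin (suc j) l)        ≡⟨ cong (c ^ l *_) (Q-rowSum n j l j≤n l≤n) ⟨
      c ^ l * sumTo n (λ k → motzkin j k * Q l k)      ≡⟨ *-distribˡ-sumTo n (c ^ l) _ ⟩
      sumTo n (λ k → c ^ l * (motzkin j k * Q l k))    ≡⟨ sumTo-cong n (λ k → x*[y*z]≡y*[x*z] (c ^ l) (motzkin j k) (Q l k)) ⟩
      sumTo n (λ k → motzkin j k * P k l)              ∎

-- Generalized Catalan numbers

module GeneralizedCatalan (r : ℤ) where

  open Moments r (+ 1 + r) r

  -- narayana m j j is the coefficient of r ^ j in c(m + 1; r).
  narayana : ℕ → ℕ → ℕ → ℤ
  narayana m a b = binom (suc m) a * binom (suc m) b - binom (suc (suc m)) a * binom m b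

  narayana-pascal : ∀ m a b → narayana (suc m) a b ≡ narayana m a b
    + (binom (suc m) a * prev (binom (suc m)) b - binom (suc (suc m)) a * prev (binom m) b)
    + (prev (binom (suc m)) a * binom (suc m) b - prev (binom (suc (suc m))) a * binom m b)
    + (prev (binom (suc m)) a * prev (binom (suc m)) b - prev (binom (suc (suc m))) a * prev (binom m) b)
  narayana-pascal m a b =
    trans (cong₂ _-_ (cong₂ _*_ (binom-suc (suc m) a) (binom-suc (suc m) b)) (cong₂ _*_ (binom-suc (suc (suc m)) a) (binom-suc m b)))
          (expand (binom (suc m) a) (prev (binom (suc m)) a) (binom (suc m) b) (prev (binom (suc m)) b)
                  (binom (suc (suc m)) a) (prev (binom (suc (suc m))) a) (binom m b) (prev (binom m) b))
    where
    expand : ∀ x x′ y y′ z z′ w w′ → (x + x′) * (y + y′) - (z + z′) * (w + w′)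
           ≡ x * y - z * w + (x * y′ - z * w′) + (x′ * y - z′ * w) + (x′ * y′ - z′ * w′)
    expand = solve-∀

  narayana-top : ∀ m b → narayana m (suc (suc (suc m))) b ≡ + 0
  narayana-top m b = trans (cong₂ (λ x y → x * binom (suc m) b - y * binom m b)
                                   (binom-vanish (ℕ.m<n⇒m<1+n (ℕ.n<1+n (suc m)))) (binom-vanish (ℕ.n<1+n (suc (suc m)))))
                           (normalise (binom (suc m) b) (binom m b))
    where
    normalise : ∀ x y → + 0 * x - + 0 * y ≡ + 0
    normalise = solve-∀

  narayana-cancel : ∀ m j → narayana m (suc j) j + narayana m (suc j) (suc j) ≡ + 0
  narayana-cancel m j = trans (cong (F X) (binom-suc (suc m) (suc j)))
                              (trans (cong (λ x → F x (x + Y)) (binom-suc m (suc j))) (normalise U V Y))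
    where
    U = binom m (suc j)
    V = binom m j
    X = binom (suc m) (suc j)
    Y = binom (suc m) j
    F : ℤ → ℤ → ℤ
    F x y = x * Y - y * V + (x * x - y * U)
    normalise : ∀ u v y → (u + v) * y - ((u + v) + y) * v + ((u + v) * (u + v) - ((u + v) + y) * u) ≡ + 0
    normalise = solve-∀

  narayana-suc-diagonal : ∀ m j → narayana (suc m) j j ≡ prev (λ i → narayana m i (suc i) + narayana m i i) j
  narayana-suc-diagonal m zero    = refl
  narayana-suc-diagonal m (suc j) =
    trans (narayana-pascal m (suc j) (suc j))
          (drop-cancelling (narayana m (suc j) (suc j)) (narayana m (suc j) j) _ _ (narayana-cancel m j))
    where
    drop-cancelling : ∀ a b c d → b + a ≡ + 0 → a + b + c + d ≡ c + d
    drop-cancelling a b c d b+a≡0 = trans (regroup a b c d) (trans (cong (_+ (c + d)) b+a≡0) (+-identityˡ (c + d)))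
      where
      regroup : ∀ a b c d → a + b + c + d ≡ b + a + (c + d)
      regroup = solve-∀

  narayana-suc-offDiagonal : ∀ m k j → narayana (suc m) j (suc k +ℕ j)
    ≡ narayana m j (suc k +ℕ j) + narayana m j (k +ℕ j) + prev (λ i → narayana m i (suc k +ℕ suc i) + narayana m i (k +ℕ suc i)) j
  narayana-suc-offDiagonal m k zero =
    trans (narayana-pascal m zero (suc k +ℕ zero))
          (normalise (narayana m zero (suc k +ℕ zero)) (narayana m zero (k +ℕ zero))
                     (binom (suc m) (suc k +ℕ zero)) (binom m (suc k +ℕ zero)) (binom (suc m) (k +ℕ zero)) (binom m (k +ℕ zero)))
    where
    normalise : ∀ x y u v u′ v′ → x + y + (+ 0 * u - + 0 * v) + (+ 0 * u′ - + 0 * v′) ≡ x + y + + 0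
    normalise = solve-∀
  narayana-suc-offDiagonal m k (suc j) =
    trans (narayana-pascal m (suc j) (suc k +ℕ suc j)) (+-assoc (narayana m (suc j) (suc k +ℕ suc j) + narayana m (suc j) (k +ℕ suc j)) _ _)

  catalanArray : ℕ → ℕ → ℤ
  catalanArray m k = sumTo (suc (suc m)) (λ j → narayana m j (k +ℕ j) * r ^ j)

  catalanArray-extend : ∀ m k → sumTo (suc (suc (suc m))) (λ j → narayana m j (k +ℕ j) * r ^ j) ≡ catalanArray m k
  catalanArray-extend m k = trans (cong (_+_ (catalanArray m k)) (trans (cong (_* r ^ suc (suc (suc m))) (narayana-top m (k +ℕ suc (suc (suc m)))))
                                                                     (*-zeroˡ (r ^ suc (suc (suc m))))))
                                  (+-identityʳ (catalanArray m k))

  sumTo-prev-^ : ∀ N (g : ℕ → ℤ) → sumTo (suc N) (λ j → prev g j * r ^ j) ≡ r * sumTo N (λ j → g j * r ^ j)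
  sumTo-prev-^ N g = begin
    sumTo (suc N) (λ j → prev g j * r ^ j)   ≡⟨ sumTo-shift N (λ j → prev g j * r ^ j) ⟩
    + 0 * + 1 + sumTo N (λ j → g j * r ^ suc j) ≡⟨ +-identityˡ _ ⟩
    sumTo N (λ j → g j * (r * r ^ j))        ≡⟨ sumTo-cong N (λ j → x*[y*z]≡y*[x*z] (g j) r (r ^ j)) ⟩
    sumTo N (λ j → r * (g j * r ^ j))        ≡⟨ *-distribˡ-sumTo N r (λ j → g j * r ^ j) ⟨
    r * sumTo N (λ j → g j * r ^ j)          ∎

  catalanArray-suc-zero : ∀ m → catalanArray (suc m) 0 ≡ r * catalanArray m 0 + r * catalanArray m 1
  catalanArray-suc-zero m = begin
    catalanArray (suc m) 0
      ≡⟨ sumTo-cong (suc (suc (suc m))) (λ j → cong (_* r ^ j) (narayana-suc-diagonal m j)) ⟩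
    sumTo (suc (suc (suc m))) (λ j → prev g j * r ^ j)
      ≡⟨ sumTo-prev-^ (suc (suc m)) g ⟩
    r * sumTo (suc (suc m)) (λ j → g j * r ^ j)
      ≡⟨ cong (r *_) (trans (sumTo-cong (suc (suc m)) (λ j → *-distribʳ-+ (r ^ j) (narayana m j (suc j)) (narayana m j j)))
                            (sumTo-distrib-+ (suc (suc m)) _ _)) ⟩
    r * (catalanArray m 1 + catalanArray m 0)
      ≡⟨ normalise r (catalanArray m 1) (catalanArray m 0) ⟩
    r * catalanArray m 0 + r * catalanArray m 1 ∎
    where
    g : ℕ → ℤ
    g i = narayana m i (suc i) + narayana m i i
    normalise : ∀ r x y → r * (x + y) ≡ r * y + r * x
    normalise = solve-∀

  catalanArray-suc-suc : ∀ m k → catalanArray (suc m) (suc k)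
    ≡ catalanArray m k + (+ 1 + r) * catalanArray m (suc k) + r * catalanArray m (suc (suc k))
  catalanArray-suc-suc m k = begin
    catalanArray (suc m) (suc k)
      ≡⟨ sumTo-cong (suc (suc (suc m))) (λ j → trans (cong (_* r ^ j) (narayana-suc-offDiagonal m k j))
                                                     (distrib (narayana m j (suc k +ℕ j)) (narayana m j (k +ℕ j)) (prev g j) (r ^ j))) ⟩
    sumTo (suc (suc (suc m))) (λ j → f₁ j + f₂ j + f₃ j)
      ≡⟨ trans (sumTo-distrib-+ (suc (suc (suc m))) (λ j → f₁ j + f₂ j) f₃)
               (cong (_+ sumTo (suc (suc (suc m))) f₃) (sumTo-distrib-+ (suc (suc (suc m))) f₁ f₂)) ⟩
    sumTo (suc (suc (suc m))) f₁ + sumTo (suc (suc (suc m))) f₂ + sumTo (suc (suc (suc m))) f₃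
      ≡⟨ cong₂ _+_ (cong₂ _+_ (catalanArray-extend m (suc k)) (catalanArray-extend m k)) (sumTo-prev-^ (suc (suc m)) g) ⟩
    catalanArray m (suc k) + catalanArray m k + r * sumTo (suc (suc m)) (λ j → g j * r ^ j)
      ≡⟨ cong (λ x → catalanArray m (suc k) + catalanArray m k + r * x)
           (trans (sumTo-cong (suc (suc m)) (λ j → trans (cong (_* r ^ j) (cong₂ _+_ (cong (narayana m j ∘ suc) (ℕ.+-suc k j))
                                                                                       (cong (narayana m j) (ℕ.+-suc k j))))
                                                        (*-distribʳ-+ (r ^ j) (narayana m j (suc (suc k) +ℕ j)) (narayana m j (suc k +ℕ j)))))
                  (sumTo-distrib-+ (suc (suc m)) _ _)) ⟩
    catalanArray m (suc k) + catalanArray m k + r * (catalanArray m (suc (suc k)) + catalanArray m (suc k))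
      ≡⟨ normalise r (catalanArray m k) (catalanArray m (suc k)) (catalanArray m (suc (suc k))) ⟩
    catalanArray m k + (+ 1 + r) * catalanArray m (suc k) + r * catalanArray m (suc (suc k)) ∎
    where
    g f₁ f₂ f₃ : ℕ → ℤ
    g i = narayana m i (suc k +ℕ suc i) + narayana m i (k +ℕ suc i)
    f₁ j = narayana m j (suc k +ℕ j) * r ^ j
    f₂ j = narayana m j (k +ℕ j) * r ^ j
    f₃ j = prev g j * r ^ j
    distrib : ∀ a b c p → (a + b + c) * p ≡ a * p + b * p + c * p
    distrib = solve-∀
    normalise : ∀ r a b c → b + a + r * (c + b) ≡ a + (+ 1 + r) * b + r * c
    normalise = solve-∀

  motzkin≡catalanArray : ∀ m k → motzkin (suc m) k ≡ catalanArray m k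
  motzkin≡catalanArray zero zero = normalise r
    where
    normalise : ∀ r → r * + 1 + r * + 0 ≡ + 0 * + 1 + + 1 * (r * + 1) + + 0 * (r * (r * + 1))
    normalise = solve-∀
  motzkin≡catalanArray zero (suc zero) = normalise r
    where
    normalise : ∀ r → + 1 + (+ 1 + r) * + 0 + r * + 0 ≡ + 1 * + 1 + + 0 * (r * + 1) + + 0 * (r * (r * + 1))
    normalise = solve-∀
  motzkin≡catalanArray zero (suc (suc k)) = normalise r
    where
    normalise : ∀ r → + 0 + (+ 1 + r) * + 0 + r * + 0 ≡ + 0 * + 1 + + 0 * (r * + 1) + + 0 * (r * (r * + 1))
    normalise = solve-∀
  motzkin≡catalanArray (suc m) zero =
    trans (cong₂ (λ x y → r * x + r * y) (motzkin≡catalanArray m 0) (motzkin≡catalanArray m 1)) (sym (catalanArray-suc-zero m))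
  motzkin≡catalanArray (suc m) (suc k) =
    trans (cong₂ _+_ (cong₂ (λ x y → x + (+ 1 + r) * y) (motzkin≡catalanArray m k) (motzkin≡catalanArray m (suc k)))
                     (cong (r *_) (motzkin≡catalanArray m (suc (suc k)))))
          (sym (catalanArray-suc-suc m k))

  catalan≡moment : ∀ m → catalan r m ≡ moment m
  catalan≡moment zero    = refl
  catalan≡moment (suc m) = begin
    catalan r (suc m)
      ≡⟨ sumTo-distrib-- (suc (suc m)) (λ j → binom (suc m) j * binom (suc m) j * r ^ j)
                                       (λ j → binom (suc (suc m)) j * binom m j * r ^ j) ⟨
    sumTo (suc (suc m)) (λ j → binom (suc m) j * binom (suc m) j * r ^ j - binom (suc (suc m)) j * binom m j * r ^ j)
      ≡⟨ sumTo-cong (suc (suc m)) (λ j → factor (binom (suc m) j) (binom (suc (suc m)) j) (binom m j) (r ^ j)) ⟩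
    catalanArray m 0
      ≡⟨ motzkin≡catalanArray m 0 ⟨
    moment (suc m) ∎
    where
    factor : ∀ a b c p → a * a * p - b * c * p ≡ (a * a - b * c) * p
    factor = solve-∀

  bcoef-recurrence : Recurrence (r + + 2) (- r) (bcoef r)
  bcoef-recurrence m = cong (_+_ ((r + + 2) * bcoef r (suc m))) (neg-distribˡ-* r (bcoef r m))

  continuant : ℕ → ℤ
  continuant = tridiagonalDet (+ 1 + (+ 1 + r)) (+ 1) (+ 1 + (+ 1 + r)) r

  continuant-recurrence : Recurrence (r + + 2) (- r) continuant
  continuant-recurrence m = trans (tridiagonalDet-expand (+ 1 + (+ 1 + r)) (+ 1) (+ 1 + (+ 1 + r)) r m)
                                  (normalise r (continuant (suc m)) (continuant m))
    where
    normalise : ∀ r x y → (+ 1 + (+ 1 + r)) * x - r * + 1 * y ≡ (r + + 2) * x + (- r) * y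
    normalise = solve-∀

  continuant-1 : continuant 1 ≡ r + + 2
  continuant-1 = trans (tridiagonalDet-1 (+ 1 + (+ 1 + r)) (+ 1) (+ 1 + (+ 1 + r)) r) (normalise r)
    where
    normalise : ∀ r → + 1 + (+ 1 + r) ≡ r + + 2
    normalise = solve-∀

  continuant≡fibPoly : continuant ≗ fibPoly (r + + 2) (- r)
  continuant≡fibPoly = Recurrence-unique (r + + 2) (- r) continuant-recurrence (fibPoly-recurrence (r + + 2) (- r))
                                         refl (trans continuant-1 (sym (fibPoly-1 (r + + 2) (- r))))

  bcoef≡Δfib : ∀ n → bcoef r (suc n) ≡ fibPoly (r + + 2) (- r) (suc n) - fibPoly (r + + 2) (- r) n
  bcoef≡Δfib = Recurrence-unique (r + + 2) (- r) (bcoef-recurrence ∘ suc)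
                                (Recurrence-difference (r + + 2) (- r) (fibPoly-recurrence (r + + 2) (- r)))
    (trans (normalise₁ r) (cong (_- + 1) (sym (fibPoly-1 (r + + 2) (- r)))))
    (trans (normalise₂ r) (sym (cong₂ _-_ (trans (fibPoly-recurrence (r + + 2) (- r) 0)
                                                 (cong (λ x → (r + + 2) * x + (- r) * + 1) (fibPoly-1 (r + + 2) (- r))))
                                          (fibPoly-1 (r + + 2) (- r)))))
    where
    normalise₁ : ∀ r → (r + + 2) * + 1 - + 1 ≡ r + + 2 - + 1
    normalise₁ = solve-∀
    normalise₂ : ∀ r → (r + + 2) * ((r + + 2) * + 1 - + 1) - r * + 1 ≡ (r + + 2) * (r + + 2) + (- r) * + 1 - (r + + 2)
    normalise₂ = solve-∀

  bcoef≡binomialTransform : bcoef r ≗ binomialTransform (fibPoly r (+ 1))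
  bcoef≡binomialTransform = Recurrence-unique (r + + 2) (- r) bcoef-recurrence
    (λ m → trans (binomialTransform-recurrence r (+ 1) (fibPoly-recurrence r (+ 1)) m)
                 (cong (λ q → (r + + 2) * binomialTransform (fibPoly r (+ 1)) (suc m) + q * binomialTransform (fibPoly r (+ 1)) m)
                       (normalise₁ r)))
    refl (trans (normalise₂ r) (cong (λ x → + 1 * + 1 + + 1 * x) (sym (fibPoly-1 r (+ 1)))))
    where
    normalise₁ : ∀ r → + 1 - r - + 1 ≡ - r
    normalise₁ = solve-∀
    normalise₂ : ∀ r → (r + + 2) * + 1 - + 1 ≡ + 1 * + 1 + + 1 * r
    normalise₂ = solve-∀

  tridiagonalDet≡Δcontinuant : ∀ n → tridiagonalDet (+ 1 + r) (+ 1) (+ 1 + (+ 1 + r)) r (suc n) ≡ continuant (suc n) - continuant n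
  tridiagonalDet≡Δcontinuant zero = trans (tridiagonalDet-1 (+ 1 + r) (+ 1) (+ 1 + (+ 1 + r)) r)
                                          (trans (normalise r) (cong (_- + 1) (sym continuant-1)))
    where
    normalise : ∀ r → + 1 + r ≡ r + + 2 - + 1
    normalise = solve-∀
  tridiagonalDet≡Δcontinuant (suc n) =
    trans (tridiagonalDet-expand (+ 1 + r) (+ 1) (+ 1 + (+ 1 + r)) r n)
          (trans (normalise r (continuant (suc n)) (continuant n))
                 (cong (_- continuant (suc n)) (sym (tridiagonalDet-expand (+ 1 + (+ 1 + r)) (+ 1) (+ 1 + (+ 1 + r)) r n))))
    where
    normalise : ∀ r x y → (+ 1 + r) * x - r * + 1 * y ≡ (+ 1 + (+ 1 + r)) * x - r * + 1 * y - x
    normalise = solve-∀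

  hankel-catSeq : ∀ n → hankel (catSeq r) n ≡ r ^ (suc n C 2) * bcoef r (suc n)
  hankel-catSeq n = begin
    hankel (catSeq r) n
      ≡⟨ det-cong (suc n) (λ i j → cong₂ _+_ (catalan≡moment (toℕ i +ℕ toℕ j)) (catalan≡moment (suc (toℕ i +ℕ toℕ j)))) ⟩
    hankel (λ k → moment k + moment (suc k)) n
      ≡⟨ hankel-moments n ⟩
    r ^ (suc n C 2) * tridiagonalDet (+ 1 + r) (+ 1) (+ 1 + (+ 1 + r)) r (suc n)
      ≡⟨ cong (r ^ (suc n C 2) *_) (begin
           tridiagonalDet (+ 1 + r) (+ 1) (+ 1 + (+ 1 + r)) r (suc n)       ≡⟨ tridiagonalDet≡Δcontinuant n ⟩
           continuant (suc n) - continuant n                                ≡⟨ cong₂ _-_ (continuant≡fibPoly (suc n)) (continuant≡fibPoly n) ⟩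
           fibPoly (r + + 2) (- r) (suc n) - fibPoly (r + + 2) (- r) n      ≡⟨ bcoef≡Δfib n ⟨
           bcoef r (suc n)                                                  ∎) ⟩
    r ^ (suc n C 2) * bcoef r (suc n) ∎

mainTheorem6 : (r : ℤ) (n : ℕ) →
    (hankel (catSeq r) n
      ≡ r ^ (suc n C 2)
        * (sumTo ⌊ suc n /2⌋ (λ k → binom (suc n ∸ k) k * (- r) ^ k * (r + + 2) ^ (suc n ∸ 2 *ℕ k))
           - sumTo ⌊ n /2⌋ (λ k → binom (n ∸ k) k * (- r) ^ k * (r + + 2) ^ (n ∸ 2 *ℕ k))))
    × (hankel (catSeq r) n ≡ r ^ (suc n C 2) * bcoef r (suc n))
    × (hankel (catSeq r) n
      ≡ r ^ (suc n C 2)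
        * (sumTo (suc n) (λ k → binom k (suc n ∸ k) * (r + + 2) ^ (2 *ℕ k ∸ suc n) * (- r) ^ (suc n ∸ k))
           - sumTo n (λ k → binom k (n ∸ k) * (r + + 2) ^ (2 *ℕ k ∸ n) * (- r) ^ (n ∸ k))))
    × (hankel (catSeq r) n
      ≡ r ^ (suc n C 2)
        * sumTo (suc n) (λ k → binom (suc n) k * sumTo k (λ j → binom j (k ∸ j) * r ^ (2 *ℕ j ∸ k))))
    × (hankel (catSeq r) n
      ≡ r ^ (suc n C 2)
        * sumTo (suc n) (λ k → binom (suc n) k * sumTo ⌊ k /2⌋ (λ j → binom (k ∸ j) j * r ^ (k ∸ 2 *ℕ j))))
mainTheorem6 r n =
  via (trans (cong₂ _-_ (fibPoly-half (r + + 2) (- r) (suc n)) (fibPoly-half (r + + 2) (- r) n)) (sym (bcoef≡Δfib n))) ,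
  hankel-catSeq n ,
  via (trans (cong₂ _-_ (fibPoly-reverse (r + + 2) (- r) (suc n)) (fibPoly-reverse (r + + 2) (- r) n)) (sym (bcoef≡Δfib n))) ,
  via (trans (sumTo-cong (suc n) (λ k → cong (binom (suc n) k *_) (fibPoly-reverse-β≡1 r k))) (sym (bcoef≡binomialTransform (suc n)))) ,
  via (trans (sumTo-cong (suc n) (λ k → cong (binom (suc n) k *_) (fibPoly-half-β≡1 r k))) (sym (bcoef≡binomialTransform (suc n))))
  where
  open GeneralizedCatalan r
  via : ∀ {x} → x ≡ bcoef r (suc n) → hankel (catSeq r) n ≡ r ^ (suc n C 2) * x
  via x≡bcoef = trans (hankel-catSeq n) (cong (r ^ (suc n C 2) *_) (sym x≡bcoef))
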